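{- Let $G$ be a finite simple $d$-regular graph on $2n$ vertices which contains at least one perfect matching. Form $G_\omega$ by ordering the edges of $G$ uniformly at random and adding edges in this order (on the vertex set of $G$), stopping at the first moment when every vertex has degree at least one. Then $$\mathbb{E}\left(\frac{\#\{\text{perfect matchings contained in } G_\omega\}}{\#\{\text{perfect matchings contained in } G\}}\right)=\frac{2}{\binom{n+d-1}{n}}-\frac{1}{\binom{n+2d-2}{n}}.$$
   Context: A perfect (complete) matching is a spanning subgraph in which every vertex has degree exactly $1$. The expectation is over the uniform distribution on orderings of the edges of $G$. -}

module Defs where

open import Data.Nat using (ℕ; zero; suc; _+_; _*_; _∸_)
open import Data.Nat.Combinatorics using (_C_)
open import Data.Bool using (Bool; true; false; if_then_else_; _∧_; _∨_)
open import Data.Fin using (Fin; _<?_) renaming (_≟_ to _≟ᶠ_)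
open import Data.List using (List; []; _∷_; _∷ʳ_; map; concatMap; filter; length; foldr)
open import Data.Bool.ListAction using (all; any)
open import Data.List.Base using (allFin)
open import Data.Product using (_×_; _,_; proj₁; proj₂)
open import Data.Integer using (+_)
open import Data.Rational using (ℚ; 0ℚ) renaming (_/_ to _/ℚ_; _+_ to _+ℚ_; _*_ to _*ℚ_)
open import Relation.Nullary.Decidable using (⌊_⌋; does)
open import Relation.Binary.PropositionalEquality using (_≡_)

record SimpleGraph (m : ℕ) : Set where
  field
    Adj   : Fin m → Fin m → Bool
    adj-sym    : ∀ u v → Adj u v ≡ Adj v u
    adj-irrefl : ∀ v → Adj v v ≡ false
open SimpleGraph public

Edge : ℕ → Set
Edge m = Fin m × Fin m

-- Each edge {u,v} listed exactly once, as the pair (u , v) with u < v.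
edges : ∀ {m} → SimpleGraph m → List (Edge m)
edges {m} G =
  concatMap (λ u → map (λ v → (u , v))
              (filter (λ v → u <? v) (filter (λ v → Adj G u v ≟ᵇ true) (allFin m))))
            (allFin m)
  where
    open import Data.Bool.Properties using () renaming (_≟_ to _≟ᵇ_)

degree : ∀ {m} → SimpleGraph m → Fin m → ℕ
degree {m} G v = length (filter (λ u → Adj G v u ≟ᵇ true) (allFin m))
  where
    open import Data.Bool.Properties using () renaming (_≟_ to _≟ᵇ_)

Regular : ∀ {m} → ℕ → SimpleGraph m → Set
Regular d G = ∀ v → degree G v ≡ d

incident : ∀ {m} → Fin m → Edge m → Bool
incident v (a , b) = ⌊ v ≟ᶠ a ⌋ ∨ ⌊ v ≟ᶠ b ⌋

degIn : ∀ {m} → List (Edge m) → Fin m → ℕ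
degIn H v = length (filter (λ e → incident v e ≟ᵇ true) H)
  where
    open import Data.Bool.Properties using () renaming (_≟_ to _≟ᵇ_)

isPerfectMatching : ∀ {m} → List (Edge m) → Bool
isPerfectMatching {m} S = all (λ v → ⌊ degIn S v Data.Nat.≟ 1 ⌋) (allFin m)
  where import Data.Nat

coversAll : ∀ {m} → List (Edge m) → Bool
coversAll {m} H = all (λ v → any (incident v) H) (allFin m)

-- all sub-lists (= all subsets, when the list has no repetitions)
sublists : ∀ {A : Set} → List A → List (List A)
sublists [] = [] ∷ []
sublists (x ∷ xs) = let r = sublists xs in map (x ∷_) r Data.List.++ r
  where import Data.List

#PM : ∀ {m} → List (Edge m) → ℕ
#PM H = length (filter (λ S → isPerfectMatching S ≟ᵇ true) (sublists H))
  where
    open import Data.Bool.Properties using () renaming (_≟_ to _≟ᵇ_)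

insertions : ∀ {A : Set} → A → List A → List (List A)
insertions x [] = (x ∷ []) ∷ []
insertions x (y ∷ ys) = (x ∷ y ∷ ys) ∷ map (y ∷_) (insertions x ys)

orderings : ∀ {A : Set} → List A → List (List A)
orderings [] = [] ∷ []
orderings (x ∷ xs) = concatMap (insertions x) (orderings xs)

stopAt : ∀ {m} → List (Edge m) → List (Edge m) → List (Edge m)
stopAt acc [] = acc
stopAt acc (e ∷ es) = if coversAll acc then acc else stopAt (acc ∷ʳ e) es

Gω : ∀ {m} → List (Edge m) → List (Edge m)
Gω ω = stopAt [] ω

-- rational a / b (convention a / 0 = 0; only used with nonzero b)
_÷_ : ℕ → ℕ → ℚ
a ÷ zero = 0ℚ
a ÷ suc b = (+ a) /ℚ (suc b)

sumℚ : List ℚ → ℚ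
sumℚ = foldr _+ℚ_ 0ℚ

mean : List ℚ → ℚ
mean xs = sumℚ xs *ℚ (1 ÷ length xs)

expectedPMRatio : ∀ {m} → SimpleGraph m → ℚ
expectedPMRatio G =
  mean (map (λ ω → #PM (Gω ω) ÷ #PM (edges G)) (orderings (edges G)))

-- By linearity of expectation it suffices to show that each perfect matching M of G
-- (with n edges) lies in G_ω with probability 2 / C(n+d-1,n) - 1 / C(n+2d-2,n).
-- Let e = uv be the edge of M that comes last in ω.  Just before e, every vertex other
-- than u and v is already covered by M, so M ⊆ G_ω exactly when u or v is still
-- isolated at that moment, i.e. when all d - 1 other edges at u (or at v) come after e.
-- For disjoint sets X, Y of edges avoiding e, the orderings in which X precedes e and
-- e precedes Y form the fraction |X|! |Y|! / (|X| + |Y| + 1)!.  Taking X = M - e and Y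
-- the other edges at u, at v, or at both (2d - 2 distinct edges, as G is simple),
-- inclusion-exclusion and the n choices of e give the claimed probability.

{-# OPTIONS --safe #-}
module Submission where

open import Defs

open import Data.Bool using (Bool; true; false; _∧_; _∨_; not)
open import Data.Bool.ListAction using (all; any)
import Data.Bool.Properties as Boolₚ
open import Data.Empty using (⊥-elim)
open import Data.Fin using (Fin; zero; _<?_) renaming (_<_ to _<ᶠ_)
import Data.Fin.Properties as Finₚ
open import Data.Integer as ℤ using (ℤ; +_)
import Data.Integer.Properties as ℤₚ
import Data.Integer.Tactic.RingSolver as ℤ-Solver
open import Data.List using (List; []; _∷_; _++_; [_]; _∷ʳ_; map; concatMap; length; filter; takeWhile; allFin)
open import Data.List.Properties
  using (length-++; length-map; length-tabulate; map-++; concatMap-++; filter-all; ++-assoc; ++-identityʳ)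
open import Data.List.Membership.Propositional using (_∈_; _∉_; find)
open import Data.List.Membership.Propositional.Properties
  using (∈-map⁻; ∈-concatMap⁻; ∈-++⁺ˡ; ∈-++⁺ʳ; ∈-++⁻; ∈-filter⁺; ∈-filter⁻; ∈-allFin)
open import Data.List.Membership.Propositional.Properties.WithK using (unique∧set⇒bag)
open import Data.List.Relation.Binary.BagAndSetEquality using (∼bag⇒↭)
open import Data.List.Relation.Binary.Disjoint.Propositional using (Disjoint)
open import Data.List.Relation.Binary.Permutation.Propositional
  using (_↭_; ↭-refl; ↭-sym; ↭-trans; ↭-prep; ↭-swap; ↭⇒↭ₛ)
import Data.List.Relation.Binary.Permutation.Propositional as ↭
open import Data.List.Relation.Binary.Permutation.Propositional.Properties
  using (shift; shifts; map⁺; ++⁺; ++⁺ˡ; ↭-length; ∈-resp-↭; filter-↭)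
open import Data.List.Relation.Binary.Permutation.Setoid.Properties using (Unique-resp-↭)
import Data.List.Relation.Unary.All as All
open import Data.List.Relation.Unary.All using (All; []; _∷_)
import Data.List.Relation.Unary.All.Properties as Allₚ
import Data.List.Relation.Unary.AllPairs as AllPairs
open import Data.List.Relation.Unary.AllPairs using ([]; _∷_)
import Data.List.Relation.Unary.AllPairs.Properties as AllPairsₚ
open import Data.List.Relation.Unary.Any using (here; there)
open import Data.List.Relation.Unary.Unique.Propositional using (Unique)
import Data.List.Relation.Unary.Unique.Propositional.Properties as Uniqueₚ
open import Data.List.Relation.Unary.Unique.Propositional.Properties using (filter⁺; Unique[x∷xs]⇒x∉xs)
open import Data.Nat using (ℕ; zero; suc; _+_; _*_; _∸_; _≤_; _≥_; _!; s≤s; z≤n)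
import Data.Nat as ℕ
open import Data.Nat.Combinatorics using (_C_; k![n∸k]!∣n!)
open import Data.Nat.Combinatorics.Specification using (nCk≡n!/k![n-k]!)
open import Data.Nat.Divisibility using (_∣_)
open import Data.Nat.DivMod using (_/_; m/n*n≡m)
open import Data.Nat.Properties hiding (_<?_; _≟_)
open import Data.Nat.Tactic.RingSolver using (solve-∀)
open import Algebra.Properties.CommutativeSemigroup +-commutativeSemigroup
  using () renaming (interchange to +-interchange)
open import Algebra.Properties.CommutativeSemigroup *-commutativeSemigroup
  using () renaming (x∙yz≈y∙xz to m*[n*o]≡n*[m*o])
open import Data.Product using (_×_; _,_; proj₁; proj₂; ∃)
open import Data.Product.Properties using (≡-dec; ,-injectiveʳ)
open import Data.Rational as ℚ using (toℚᵘ) renaming (_+_ to _+ℚ_; _*_ to _*ℚ_; _-_ to _-ℚ_)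
import Data.Rational.Properties as ℚₚ
open import Data.Rational.Unnormalised as ℚᵘ using (mkℚᵘ; *≡*) renaming (_≃_ to _≃ᵘ_)
import Data.Rational.Unnormalised.Properties as ℚᵘₚ
open import Data.Sum using (_⊎_; inj₁; inj₂; [_,_]′)
open import Function using (_∘_; id)
open import Function.Bundles using (mk⇔)
open import Relation.Binary.Definitions using (DecidableEquality; tri<; tri≈; tri>)
open import Relation.Binary.PropositionalEquality hiding ([_])
open import Relation.Nullary using (does; yes; no; ¬?)
open import Relation.Nullary.Decidable using (isYes; isYes≗does; dec-true; dec-false)
open import Relation.Unary using (Decidable)

private variable
  A B Z : Set

𝟙 : Bool → ℕ
𝟙 true  = 1
𝟙 false = 0

∑ : (A → ℕ) → List A → ℕ
∑ f []       = 0
∑ f (x ∷ xs) = f x + ∑ f xs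

∑-++ : (f : A → ℕ) (xs ys : List A) → ∑ f (xs ++ ys) ≡ ∑ f xs + ∑ f ys
∑-++ f []       ys = refl
∑-++ f (x ∷ xs) ys = trans (cong (_+_ (f x)) (∑-++ f xs ys)) (sym (+-assoc (f x) _ _))

∑-map : (f : B → ℕ) (g : A → B) (xs : List A) → ∑ f (map g xs) ≡ ∑ (f ∘ g) xs
∑-map f g []       = refl
∑-map f g (x ∷ xs) = cong (_+_ (f (g x))) (∑-map f g xs)

∑-concatMap : (f : B → ℕ) (g : A → List B) (xs : List A) →
              ∑ f (concatMap g xs) ≡ ∑ (∑ f ∘ g) xs
∑-concatMap f g []       = refl
∑-concatMap f g (x ∷ xs) =
  trans (∑-++ f (g x) (concatMap g xs)) (cong (_+_ (∑ f (g x))) (∑-concatMap f g xs))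

∑-cong-∈ : {f g : A → ℕ} (xs : List A) → (∀ {x} → x ∈ xs → f x ≡ g x) → ∑ f xs ≡ ∑ g xs
∑-cong-∈ []       h = refl
∑-cong-∈ (x ∷ xs) h = cong₂ _+_ (h (here refl)) (∑-cong-∈ xs (h ∘ there))

∑-cong : {f g : A → ℕ} (xs : List A) → (∀ x → f x ≡ g x) → ∑ f xs ≡ ∑ g xs
∑-cong xs h = ∑-cong-∈ xs (λ {x} _ → h x)

∑-+ : (f g : A → ℕ) (xs : List A) → ∑ (λ x → f x + g x) xs ≡ ∑ f xs + ∑ g xs
∑-+ f g []       = refl
∑-+ f g (x ∷ xs) = trans (cong (_+_ (f x + g x)) (∑-+ f g xs)) (+-interchange (f x) (g x) _ _)

∑-*ˡ : (c : ℕ) (f : A → ℕ) (xs : List A) → ∑ (λ x → c * f x) xs ≡ c * ∑ f xs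
∑-*ˡ c f []       = sym (*-zeroʳ c)
∑-*ˡ c f (x ∷ xs) = trans (cong (_+_ (c * f x)) (∑-*ˡ c f xs)) (sym (*-distribˡ-+ c (f x) (∑ f xs)))

∑-*ʳ : (f : A → ℕ) (c : ℕ) (xs : List A) → ∑ (λ x → f x * c) xs ≡ ∑ f xs * c
∑-*ʳ f c xs = trans (∑-cong xs (λ x → *-comm (f x) c)) (trans (∑-*ˡ c f xs) (*-comm c (∑ f xs)))

∑-const : (c : ℕ) (xs : List A) → ∑ (λ _ → c) xs ≡ length xs * c
∑-const c []       = refl
∑-const c (x ∷ xs) = cong (_+_ c) (∑-const c xs)

∑-zero : {f : A → ℕ} (xs : List A) → (∀ {x} → x ∈ xs → f x ≡ 0) → ∑ f xs ≡ 0
∑-zero xs h = trans (∑-cong-∈ xs h) (trans (∑-const 0 xs) (*-zeroʳ (length xs)))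

∑-↭ : (f : A → ℕ) {xs ys : List A} → xs ↭ ys → ∑ f xs ≡ ∑ f ys
∑-↭ f ↭.refl        = refl
∑-↭ f (↭.prep x p)  = cong (_+_ (f x)) (∑-↭ f p)
∑-↭ f (↭.swap {xs} {ys} x y p) = begin
  f x + (f y + ∑ f xs) ≡⟨ sym (+-assoc (f x) (f y) _) ⟩
  f x + f y + ∑ f xs   ≡⟨ cong₂ _+_ (+-comm (f x) (f y)) (∑-↭ f p) ⟩
  f y + f x + ∑ f ys   ≡⟨ +-assoc (f y) (f x) _ ⟩
  f y + (f x + ∑ f ys) ∎
  where open ≡-Reasoning
∑-↭ f (↭.trans p q) = trans (∑-↭ f p) (∑-↭ f q)

∑-comm : (f : A → B → ℕ) (xs : List A) (ys : List B) →
         ∑ (λ x → ∑ (f x) ys) xs ≡ ∑ (λ y → ∑ (λ x → f x y) xs) ys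
∑-comm f []       ys = sym (∑-zero ys (λ _ → refl))
∑-comm f (x ∷ xs) ys =
  trans (cong (_+_ (∑ (f x) ys)) (∑-comm f xs ys)) (sym (∑-+ (f x) (λ y → ∑ (λ x → f x y) xs) ys))

≤-∑ : (f : A → ℕ) {xs : List A} {x : A} → x ∈ xs → f x ≤ ∑ f xs
≤-∑ f {y ∷ xs} (here refl) = m≤m+n (f y) (∑ f xs)
≤-∑ f {y ∷ xs} (there i)   = ≤-trans (≤-∑ f i) (m≤n+m (∑ f xs) (f y))

∑-positive : (f : A → ℕ) (xs : List A) → 1 ≤ ∑ f xs → ∃ λ x → x ∈ xs × 1 ≤ f x
∑-positive f (x ∷ xs) h with f x in eq
... | suc _ = x , here refl , subst (1 ≤_) (sym eq) (s≤s z≤n)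
... | zero  = let (y , i , p) = ∑-positive f xs h in y , there i , p

𝟙-∧ : ∀ a b → 𝟙 (a ∧ b) ≡ 𝟙 a * 𝟙 b
𝟙-∧ true  b = sym (+-identityʳ (𝟙 b))
𝟙-∧ false b = refl

𝟙-∨ : ∀ a b → 𝟙 (a ∨ b) + 𝟙 (a ∧ b) ≡ 𝟙 a + 𝟙 b
𝟙-∨ true  true  = refl
𝟙-∨ true  false = refl
𝟙-∨ false b     = +-identityʳ (𝟙 b)

𝟙-∨-disjoint : ∀ a b → (a ∧ b) ≡ false → 𝟙 (a ∨ b) ≡ 𝟙 a + 𝟙 b
𝟙-∨-disjoint a b h = trans (sym (+-identityʳ _)) (trans (cong (λ c → 𝟙 (a ∨ b) + 𝟙 c) (sym h)) (𝟙-∨ a b))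

𝟙-∧-inclusion-exclusion : ∀ x a b → 𝟙 (x ∧ (a ∨ b)) + 𝟙 (x ∧ (a ∧ b)) ≡ 𝟙 (x ∧ a) + 𝟙 (x ∧ b)
𝟙-∧-inclusion-exclusion true  a b = 𝟙-∨ a b
𝟙-∧-inclusion-exclusion false a b = refl

𝟙-not : ∀ b → 𝟙 b + 𝟙 (not b) ≡ 1
𝟙-not true  = refl
𝟙-not false = refl

𝟙-positive : ∀ b → 1 ≤ 𝟙 b → b ≡ true
𝟙-positive true _ = refl

𝟙-∧-cong : ∀ a {b c} → (a ≡ true → b ≡ c) → 𝟙 (a ∧ b) ≡ 𝟙 a * 𝟙 c
𝟙-∧-cong true  h rewrite h refl = sym (+-identityʳ _)
𝟙-∧-cong false h = refl

*𝟙-cong : ∀ b (m n : ℕ) → (b ≡ true → m ≡ n) → m * 𝟙 b ≡ n * 𝟙 b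
*𝟙-cong true  m n h = cong (_* 1) (h refl)
*𝟙-cong false m n h = trans (*-zeroʳ m) (sym (*-zeroʳ n))

true≢false : true ≢ false
true≢false ()

∧-true⁻ : ∀ {a b} → (a ∧ b) ≡ true → a ≡ true × b ≡ true
∧-true⁻ {true} {true} _ = refl , refl

∧-leftComm : ∀ a b c → (a ∧ (b ∧ c)) ≡ (b ∧ (a ∧ c))
∧-leftComm true  b     c = refl
∧-leftComm false true  c = refl
∧-leftComm false false c = refl

not-true⁻ : ∀ {a} → not a ≡ true → a ≡ false
not-true⁻ {false} _ = refl

not-false⁻ : ∀ {a} → not a ≡ false → a ≡ true
not-false⁻ {true} _ = refl

not-∧-not : ∀ a b → not (not a ∧ not b) ≡ (a ∨ b)
not-∧-not true  b = refl
not-∧-not false b = Boolₚ.not-involutive b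

bool-ext : ∀ {a b : Bool} → (a ≡ true → b ≡ true) → (b ≡ true → a ≡ true) → a ≡ b
bool-ext {true}  f g = sym (f refl)
bool-ext {false} {true} f g = g refl
bool-ext {false} {false} f g = refl

all-sound : (f : A → Bool) {xs : List A} → all f xs ≡ true → ∀ {x} → x ∈ xs → f x ≡ true
all-sound f h (here refl) = proj₁ (∧-true⁻ h)
all-sound f h (there i)   = all-sound f (proj₂ (∧-true⁻ {a = f _} h)) i

all-complete : (f : A → Bool) (xs : List A) → (∀ {x} → x ∈ xs → f x ≡ true) → all f xs ≡ true
all-complete f []       h = refl
all-complete f (x ∷ xs) h rewrite h (here refl) = all-complete f xs (h ∘ there)

all-false : (f : A → Bool) {xs : List A} {x : A} → x ∈ xs → f x ≡ false → all f xs ≡ false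
all-false f (here refl) h rewrite h = refl
all-false f {y ∷ xs} (there i) h rewrite all-false f i h = Boolₚ.∧-zeroʳ (f y)

all-false-sound : (f : A → Bool) (xs : List A) → all f xs ≡ false → ∃ λ x → x ∈ xs × f x ≡ false
all-false-sound f (x ∷ xs) h with f x in eq
... | false = x , here refl , eq
... | true  = let (y , i , p) = all-false-sound f xs h in y , there i , p

all-cong-∈ : {f g : A → Bool} (xs : List A) → (∀ {x} → x ∈ xs → f x ≡ g x) → all f xs ≡ all g xs
all-cong-∈ []       h = refl
all-cong-∈ (x ∷ xs) h = cong₂ _∧_ (h (here refl)) (all-cong-∈ xs (h ∘ there))

all-++ : (f : A → Bool) (xs ys : List A) → all f (xs ++ ys) ≡ (all f xs ∧ all f ys)
all-++ f []       ys = refl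
all-++ f (x ∷ xs) ys rewrite all-++ f xs ys = sym (Boolₚ.∧-assoc (f x) (all f xs) (all f ys))

any-sound : (f : A → Bool) (xs : List A) → any f xs ≡ true → ∃ λ x → x ∈ xs × f x ≡ true
any-sound f (x ∷ xs) h with f x in eq
... | true  = x , here refl , eq
... | false = let (y , i , p) = any-sound f xs h in y , there i , p

any-complete : (f : A → Bool) {xs : List A} {x : A} → x ∈ xs → f x ≡ true → any f xs ≡ true
any-complete f (here refl) h rewrite h = refl
any-complete f {y ∷ xs} (there i) h rewrite any-complete f i h = Boolₚ.∨-zeroʳ (f y)

any-++ : (f : A → Bool) (xs ys : List A) → any f (xs ++ ys) ≡ (any f xs ∨ any f ys)
any-++ f []       ys = refl
any-++ f (x ∷ xs) ys rewrite any-++ f xs ys = sym (Boolₚ.∨-assoc (f x) (any f xs) (any f ys))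

holds? : (q : A → Bool) → Decidable (λ x → q x ≡ true)
holds? q x = q x Boolₚ.≟ true

does-holds : (q : A → Bool) (x : A) → does (holds? q x) ≡ q x
does-holds q x with q x
... | true  = refl
... | false = refl

length-filter-holds : (q : A → Bool) (xs : List A) → length (filter (holds? q) xs) ≡ ∑ (𝟙 ∘ q) xs
length-filter-holds q []       = refl
length-filter-holds q (x ∷ xs) with q x
... | true  = cong suc (length-filter-holds q xs)
... | false = length-filter-holds q xs

∑-filter : {P : A → Set} (P? : Decidable P) (g : A → ℕ) (xs : List A) →
           ∑ g (filter P? xs) ≡ ∑ (λ x → 𝟙 (does (P? x)) * g x) xs
∑-filter P? g []       = refl
∑-filter P? g (x ∷ xs) with does (P? x)
... | true  = cong₂ _+_ (sym (+-identityʳ (g x))) (∑-filter P? g xs)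
... | false = ∑-filter P? g xs

filter-partition-↭ : (q : A → Bool) (xs : List A) →
                     xs ↭ filter (holds? (not ∘ q)) xs ++ filter (holds? q) xs
filter-partition-↭ q []       = ↭-refl
filter-partition-↭ q (x ∷ xs) with q x
... | true  = ↭-trans (↭-prep x (filter-partition-↭ q xs))
                      (↭-sym (shift x (filter (holds? (not ∘ q)) xs) (filter (holds? q) xs)))
... | false = ↭-prep x (filter-partition-↭ q xs)

length≡1⇒≡ : {xs : List A} {x y : A} → length xs ≡ 1 → x ∈ xs → y ∈ xs → x ≡ y
length≡1⇒≡ {xs = _ ∷ []} _ (here refl) (here refl) = refl

Unique-↭ : {xs ys : List A} → xs ↭ ys → Unique xs → Unique ys
Unique-↭ p = Unique-resp-↭ (setoid _) (↭⇒↭ₛ p)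

Unique-same-elements⇒↭ : {xs ys : List A} → Unique xs → Unique ys →
  (∀ {z} → z ∈ xs → z ∈ ys) → (∀ {z} → z ∈ ys → z ∈ xs) → xs ↭ ys
Unique-same-elements⇒↭ u v to from = ∼bag⇒↭ (unique∧set⇒bag u v (mk⇔ to from))

Unique-∷ : {x : A} {xs : List A} → x ∉ xs → Unique xs → Unique (x ∷ xs)
Unique-∷ {xs = xs} x∉ u = All.tabulate (λ i x≡ → x∉ (subst (_∈ xs) (sym x≡) i)) ∷ u

Unique-++ˡ : (xs : List A) {ys : List A} → Unique (xs ++ ys) → Unique xs
Unique-++ˡ []       _        = []
Unique-++ˡ (x ∷ xs) (px ∷ u) = Allₚ.++⁻ˡ xs px ∷ Unique-++ˡ xs u

Unique-++ʳ : (xs : List A) {ys : List A} → Unique (xs ++ ys) → Unique ys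
Unique-++ʳ []       u       = u
Unique-++ʳ (x ∷ xs) (_ ∷ u) = Unique-++ʳ xs u

Unique-middle : (xs : List A) {z : A} {ys : List A} → Unique (xs ++ z ∷ ys) → z ∉ xs
Unique-middle (x ∷ xs) (px ∷ u) (here refl) = All.lookup px (∈-++⁺ʳ xs (here refl)) refl
Unique-middle (x ∷ xs) (px ∷ u) (there i)   = Unique-middle xs u i

-- Orderings

length-concatMap : (f : A → List B) (xs : List A) → length (concatMap f xs) ≡ ∑ (length ∘ f) xs
length-concatMap f []       = refl
length-concatMap f (x ∷ xs) = trans (length-++ (f x)) (cong (_+_ (length (f x))) (length-concatMap f xs))

length-insertions : (x : A) (xs : List A) → length (insertions x xs) ≡ suc (length xs)
length-insertions x []       = refl
length-insertions x (y ∷ ys) = cong suc (trans (length-map (y ∷_) (insertions x ys)) (length-insertions x ys))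

∈-insertions⇒↭ : (x : A) (xs : List A) {σ : List A} → σ ∈ insertions x xs → σ ↭ x ∷ xs
∈-insertions⇒↭ x []       (here refl) = ↭-refl
∈-insertions⇒↭ x (y ∷ ys) (here refl) = ↭-refl
∈-insertions⇒↭ x (y ∷ ys) (there i) with ∈-map⁻ (y ∷_) i
... | σ , j , refl = ↭-trans (↭-prep y (∈-insertions⇒↭ x ys j)) (↭-swap y x ↭-refl)

∈-orderings⇒↭ : (xs : List A) {ω : List A} → ω ∈ orderings xs → ω ↭ xs
∈-orderings⇒↭ []       (here refl) = ↭-refl
∈-orderings⇒↭ (x ∷ xs) i =
  let (τ , τ∈ , ω∈) = find (∈-concatMap⁻ (insertions x) {xs = orderings xs} i)
  in ↭-trans (∈-insertions⇒↭ x τ ω∈) (↭-prep x (∈-orderings⇒↭ xs τ∈))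

length-orderings : (xs : List A) → length (orderings xs) ≡ (length xs) !
length-orderings []       = refl
length-orderings (x ∷ xs) = begin
  length (concatMap (insertions x) (orderings xs))   ≡⟨ length-concatMap (insertions x) (orderings xs) ⟩
  ∑ (length ∘ insertions x) (orderings xs)           ≡⟨ ∑-cong-∈ (orderings xs) length-ω ⟩
  ∑ (λ _ → suc (length xs)) (orderings xs)           ≡⟨ ∑-const _ (orderings xs) ⟩
  length (orderings xs) * suc (length xs)            ≡⟨ cong (_* suc (length xs)) (length-orderings xs) ⟩
  (length xs) ! * suc (length xs)                    ≡⟨ *-comm ((length xs) !) _ ⟩
  suc (length xs) !                                  ∎
  where
  open ≡-Reasoning
  length-ω : ∀ {ω} → ω ∈ orderings xs → length (insertions x ω) ≡ suc (length xs)
  length-ω {ω} i = trans (length-insertions x ω) (cong suc (↭-length (∈-orderings⇒↭ xs i)))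

concatMap-cong-↭ : {f g : A → List B} (xs : List A) → (∀ x → f x ↭ g x) → concatMap f xs ↭ concatMap g xs
concatMap-cong-↭ []       h = ↭-refl
concatMap-cong-↭ (x ∷ xs) h = ++⁺ (h x) (concatMap-cong-↭ xs h)

concatMap-resp-↭ : (f : A → List B) {xs ys : List A} → xs ↭ ys → concatMap f xs ↭ concatMap f ys
concatMap-resp-↭ f ↭.refl          = ↭-refl
concatMap-resp-↭ f (↭.prep x p)    = ++⁺ˡ (f x) (concatMap-resp-↭ f p)
concatMap-resp-↭ f (↭.swap x y p)  = ↭-trans (shifts (f x) (f y)) (++⁺ˡ (f y) (++⁺ˡ (f x) (concatMap-resp-↭ f p)))
concatMap-resp-↭ f (↭.trans p q)   = ↭-trans (concatMap-resp-↭ f p) (concatMap-resp-↭ f q)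

concatMap-concatMap : (f : B → List Z) (g : A → List B) (xs : List A) →
                      concatMap f (concatMap g xs) ≡ concatMap (concatMap f ∘ g) xs
concatMap-concatMap f g []       = refl
concatMap-concatMap f g (x ∷ xs) =
  trans (concatMap-++ f (g x) (concatMap g xs)) (cong (concatMap f (g x) ++_) (concatMap-concatMap f g xs))

insertions-under-∷ : (x z : A) (τs : List (List A)) →
  concatMap (insertions x) (map (z ∷_) τs) ↭ map (x ∷_) (map (z ∷_) τs) ++ map (z ∷_) (concatMap (insertions x) τs)
insertions-under-∷ x z []       = ↭-refl
insertions-under-∷ x z (τ ∷ τs) = ↭-prep (x ∷ z ∷ τ) (begin
  map (z ∷_) (insertions x τ) ++ concatMap (insertions x) (map (z ∷_) τs)
    ↭⟨ ++⁺ˡ (map (z ∷_) (insertions x τ)) (insertions-under-∷ x z τs) ⟩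
  map (z ∷_) (insertions x τ) ++ map (x ∷_) (map (z ∷_) τs) ++ map (z ∷_) (concatMap (insertions x) τs)
    ↭⟨ shifts (map (z ∷_) (insertions x τ)) (map (x ∷_) (map (z ∷_) τs)) ⟩
  map (x ∷_) (map (z ∷_) τs) ++ map (z ∷_) (insertions x τ) ++ map (z ∷_) (concatMap (insertions x) τs)
    ≡⟨ cong (map (x ∷_) (map (z ∷_) τs) ++_) (sym (map-++ (z ∷_) (insertions x τ) _)) ⟩
  map (x ∷_) (map (z ∷_) τs) ++ map (z ∷_) (insertions x τ ++ concatMap (insertions x) τs) ∎)
  where open ↭.PermutationReasoning

insertions-comm : (x y : A) (τ : List A) →
  concatMap (insertions x) (insertions y τ) ↭ concatMap (insertions y) (insertions x τ)
insertions-comm x y []       = ↭-swap _ _ ↭-refl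
insertions-comm x y (z ∷ zs) = begin
  (x ∷ y ∷ z ∷ zs) ∷ (y ∷ x ∷ z ∷ zs) ∷ map (y ∷_) X′ ++ concatMap (insertions x) (map (z ∷_) Y)
    ↭⟨ ↭-prep _ (↭-prep _ (++⁺ˡ (map (y ∷_) X′) (insertions-under-∷ x z Y))) ⟩
  (x ∷ y ∷ z ∷ zs) ∷ (y ∷ x ∷ z ∷ zs) ∷ map (y ∷_) X′ ++ map (x ∷_) Y′ ++ map (z ∷_) XY
    ↭⟨ ↭-swap _ _ (shifts (map (y ∷_) X′) (map (x ∷_) Y′)) ⟩
  (y ∷ x ∷ z ∷ zs) ∷ (x ∷ y ∷ z ∷ zs) ∷ map (x ∷_) Y′ ++ map (y ∷_) X′ ++ map (z ∷_) XY
    ↭⟨ ↭-prep _ (↭-prep _ (++⁺ˡ (map (x ∷_) Y′) (++⁺ˡ (map (y ∷_) X′)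
                                                    (map⁺ (z ∷_) (insertions-comm x y zs))))) ⟩
  (y ∷ x ∷ z ∷ zs) ∷ (x ∷ y ∷ z ∷ zs) ∷ map (x ∷_) Y′ ++ map (y ∷_) X′ ++ map (z ∷_) YX
    ↭⟨ ↭-prep _ (↭-prep _ (++⁺ˡ (map (x ∷_) Y′) (↭.↭-sym (insertions-under-∷ y z X)))) ⟩
  (y ∷ x ∷ z ∷ zs) ∷ (x ∷ y ∷ z ∷ zs) ∷ map (x ∷_) Y′ ++ concatMap (insertions y) (map (z ∷_) X) ∎
  where
  open ↭.PermutationReasoning
  X  = insertions x zs
  X′ = map (z ∷_) X
  Y  = insertions y zs
  Y′ = map (z ∷_) Y
  XY = concatMap (insertions x) Y
  YX = concatMap (insertions y) X

orderings-resp-↭ : {xs ys : List A} → xs ↭ ys → orderings xs ↭ orderings ys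
orderings-resp-↭ ↭.refl       = ↭-refl
orderings-resp-↭ (↭.prep x p) = concatMap-resp-↭ (insertions x) (orderings-resp-↭ p)
orderings-resp-↭ (↭.swap {xs} {ys} x y p) = begin
  concatMap (insertions x) (concatMap (insertions y) (orderings xs))
    ≡⟨ concatMap-concatMap (insertions x) (insertions y) (orderings xs) ⟩
  concatMap (concatMap (insertions x) ∘ insertions y) (orderings xs)
    ↭⟨ concatMap-cong-↭ (orderings xs) (insertions-comm x y) ⟩
  concatMap (concatMap (insertions y) ∘ insertions x) (orderings xs)
    ≡⟨ sym (concatMap-concatMap (insertions y) (insertions x) (orderings xs)) ⟩
  concatMap (insertions y) (concatMap (insertions x) (orderings xs))
    ↭⟨ concatMap-resp-↭ (insertions y) (concatMap-resp-↭ (insertions x) (orderings-resp-↭ p)) ⟩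
  concatMap (insertions y) (concatMap (insertions x) (orderings ys)) ∎
  where open ↭.PermutationReasoning
orderings-resp-↭ (↭.trans p q) = ↭-trans (orderings-resp-↭ p) (orderings-resp-↭ q)

∑-orderings-∷ : (f g : List A → ℕ) (c : ℕ) (y : A) (T : List A) →
                (∀ {τ} → τ ↭ T → ∑ f (insertions y τ) ≡ c * g τ) →
                ∑ f (orderings (y ∷ T)) ≡ c * ∑ g (orderings T)
∑-orderings-∷ f g c y T h =
  trans (∑-concatMap f (insertions y) (orderings T))
        (trans (∑-cong-∈ (orderings T) (h ∘ ∈-orderings⇒↭ T)) (∑-*ˡ c g (orderings T)))

insertions-filter : (q : A → Bool) {r : A} → q r ≡ false → (τ : List A) {σ : List A} →
                    σ ∈ insertions r τ → filter (holds? q) σ ≡ filter (holds? q) τ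
insertions-filter q h []       (here refl) rewrite h = refl
insertions-filter q h (z ∷ zs) (here refl) rewrite h = refl
insertions-filter q h (z ∷ zs) (there i) with ∈-map⁻ (z ∷_) i
... | σ , j , refl with q z
...   | true  = cong (z ∷_) (insertions-filter q h zs j)
...   | false = insertions-filter q h zs j

-- Inserting an element rejected by q leaves filter q unchanged, and an
-- ordering of k elements has k + 1 insertion points.
∑-orderings-++-rejected : (q : A → Bool) (g : List A → ℕ) (R T : List A) → All (λ r → q r ≡ false) R →
  ∑ (g ∘ filter (holds? q)) (orderings (R ++ T)) * (length T) ! ≡
  (length R + length T) ! * ∑ (g ∘ filter (holds? q)) (orderings T)
∑-orderings-++-rejected q g []      T _        = *-comm (∑ (g ∘ filter (holds? q)) (orderings T)) _
∑-orderings-++-rejected q g (r ∷ R) T (h ∷ hs) = begin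
  ∑ g′ (orderings (r ∷ R ++ T)) * t!           ≡⟨ cong (_* t!) (∑-orderings-∷ g′ g′ (suc k) r (R ++ T) count-ω) ⟩
  suc k * ∑ g′ (orderings (R ++ T)) * t!       ≡⟨ *-assoc (suc k) (∑ g′ (orderings (R ++ T))) t! ⟩
  suc k * (∑ g′ (orderings (R ++ T)) * t!)     ≡⟨ cong (suc k *_) (∑-orderings-++-rejected q g R T hs) ⟩
  suc k * (k ! * ∑ g′ (orderings T))           ≡⟨ sym (*-assoc (suc k) (k !) (∑ g′ (orderings T))) ⟩
  suc k ! * ∑ g′ (orderings T)                 ∎
  where
  open ≡-Reasoning
  g′ = g ∘ filter (holds? q)
  t! = (length T) !
  k  = length R + length T
  count-ω : ∀ {ω} → ω ↭ R ++ T → ∑ g′ (insertions r ω) ≡ suc k * g′ ω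
  count-ω {ω} ω↭ = begin
    ∑ g′ (insertions r ω)             ≡⟨ ∑-cong-∈ (insertions r ω) (cong g ∘ insertions-filter q h ω) ⟩
    ∑ (λ _ → g′ ω) (insertions r ω)   ≡⟨ ∑-const _ (insertions r ω) ⟩
    length (insertions r ω) * g′ ω    ≡⟨ cong (_* g′ ω) (length-insertions r ω) ⟩
    suc (length ω) * g′ ω             ≡⟨ cong (λ n → suc n * g′ ω) (trans (↭-length ω↭) (length-++ R)) ⟩
    suc k * g′ ω                      ∎

∑-sublists-∷ : (f : List A → ℕ) (x : A) (xs : List A) →
               ∑ f (sublists (x ∷ xs)) ≡ ∑ (f ∘ (x ∷_)) (sublists xs) + ∑ f (sublists xs)
∑-sublists-∷ f x xs = trans (∑-++ f (map (x ∷_) (sublists xs)) (sublists xs))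
                            (cong (_+ ∑ f (sublists xs)) (∑-map f (x ∷_) (sublists xs)))

∑-sublists-↭ : (f : List A → ℕ) → (∀ {M M′} → M ↭ M′ → f M ≡ f M′) →
               {xs ys : List A} → xs ↭ ys → ∑ f (sublists xs) ≡ ∑ f (sublists ys)
∑-sublists-↭ f f-inv ↭.refl = refl
∑-sublists-↭ f f-inv (↭.prep {xs} {ys} x p) = begin
  ∑ f (sublists (x ∷ xs))                           ≡⟨ ∑-sublists-∷ f x xs ⟩
  ∑ (f ∘ (x ∷_)) (sublists xs) + ∑ f (sublists xs)  ≡⟨ cong₂ _+_ (∑-sublists-↭ (f ∘ (x ∷_)) (f-inv ∘ ↭-prep x) p)
                                                                  (∑-sublists-↭ f f-inv p) ⟩
  ∑ (f ∘ (x ∷_)) (sublists ys) + ∑ f (sublists ys)  ≡⟨ sym (∑-sublists-∷ f x ys) ⟩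
  ∑ f (sublists (x ∷ ys))                           ∎
  where open ≡-Reasoning
∑-sublists-↭ f f-inv (↭.swap {xs} {ys} x y p) = begin
  ∑ f (sublists (x ∷ y ∷ xs))
    ≡⟨ expand x y xs ⟩
  (∑ (f ∘ (x ∷_) ∘ (y ∷_)) (sublists xs) + ∑ (f ∘ (x ∷_)) (sublists xs)) + (∑ (f ∘ (y ∷_)) (sublists xs) + ∑ f (sublists xs))
    ≡⟨ cong₂ _+_ (cong₂ _+_ (trans (∑-sublists-↭ _ (f-inv ∘ ↭-prep x ∘ ↭-prep y) p)
                                   (∑-cong (sublists ys) (λ _ → f-inv (↭-swap x y ↭-refl))))
                            (∑-sublists-↭ _ (f-inv ∘ ↭-prep x) p))
                 (cong₂ _+_ (∑-sublists-↭ _ (f-inv ∘ ↭-prep y) p) (∑-sublists-↭ f f-inv p)) ⟩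
  (∑ (f ∘ (y ∷_) ∘ (x ∷_)) (sublists ys) + ∑ (f ∘ (x ∷_)) (sublists ys)) + (∑ (f ∘ (y ∷_)) (sublists ys) + ∑ f (sublists ys))
    ≡⟨ +-interchange (∑ (f ∘ (y ∷_) ∘ (x ∷_)) (sublists ys)) _ _ _ ⟩
  (∑ (f ∘ (y ∷_) ∘ (x ∷_)) (sublists ys) + ∑ (f ∘ (y ∷_)) (sublists ys)) + (∑ (f ∘ (x ∷_)) (sublists ys) + ∑ f (sublists ys))
    ≡⟨ sym (expand y x ys) ⟩
  ∑ f (sublists (y ∷ x ∷ ys)) ∎
  where
  open ≡-Reasoning
  expand : ∀ u v zs → ∑ f (sublists (u ∷ v ∷ zs)) ≡
    (∑ (f ∘ (u ∷_) ∘ (v ∷_)) (sublists zs) + ∑ (f ∘ (u ∷_)) (sublists zs)) + (∑ (f ∘ (v ∷_)) (sublists zs) + ∑ f (sublists zs))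
  expand u v zs = trans (∑-sublists-∷ f u (v ∷ zs)) (cong₂ _+_ (∑-sublists-∷ (f ∘ (u ∷_)) v zs) (∑-sublists-∷ f v zs))
∑-sublists-↭ f f-inv (↭.trans p q) = trans (∑-sublists-↭ f f-inv p) (∑-sublists-↭ f f-inv q)

∈-sublists⁻ : {xs M : List A} → Unique xs → M ∈ sublists xs → Unique M × (∀ {z} → z ∈ M → z ∈ xs)
∈-sublists⁻ {xs = []} _ (here refl) = [] , λ ()
∈-sublists⁻ {xs = x ∷ xs} (px ∷ u) i with ∈-++⁻ (map (x ∷_) (sublists xs)) i
... | inj₂ j = let (uM , M⊆) = ∈-sublists⁻ u j in uM , there ∘ M⊆
... | inj₁ j with ∈-map⁻ (x ∷_) j
...   | M , k , refl = let (uM , M⊆) = ∈-sublists⁻ u k in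
  Unique-∷ (Unique[x∷xs]⇒x∉xs (px ∷ u) ∘ M⊆) uM , λ { (here refl) → here refl ; (there z∈M) → there (M⊆ z∈M) }

-- Positions relative to a fixed element

module Arrangements {A : Set} (_≟_ : DecidableEquality A) where

  _==_ : A → A → Bool
  x == y = does (x ≟ y)

  ==-refl : ∀ x → (x == x) ≡ true
  ==-refl x = dec-true (x ≟ x) refl

  ==-≢ : ∀ {x y} → x ≢ y → (x == y) ≡ false
  ==-≢ {x} {y} = dec-false (x ≟ y)

  ==-sym : ∀ x y → (x == y) ≡ (y == x)
  ==-sym x y with x ≟ y | y ≟ x
  ... | yes _    | yes _   = refl
  ... | no _     | no _    = refl
  ... | yes refl | no y≢x  = ⊥-elim (y≢x refl)
  ... | no x≢y   | yes refl = ⊥-elim (x≢y refl)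

  _∈ᵇ_ : A → List A → Bool
  x ∈ᵇ []       = false
  x ∈ᵇ (y ∷ ys) = (x == y) ∨ (x ∈ᵇ ys)

  ∈ᵇ-complete : ∀ {x xs} → x ∈ xs → (x ∈ᵇ xs) ≡ true
  ∈ᵇ-complete {x} (here refl) rewrite ==-refl x = refl
  ∈ᵇ-complete {x} {y ∷ ys} (there i) rewrite ∈ᵇ-complete i = Boolₚ.∨-zeroʳ (x == y)

  ∈ᵇ-sound : ∀ {x} xs → (x ∈ᵇ xs) ≡ true → x ∈ xs
  ∈ᵇ-sound {x} (y ∷ ys) h with x ≟ y
  ... | yes x≡y = here x≡y
  ... | no _    = there (∈ᵇ-sound ys h)

  ∈ᵇ-false : ∀ {x} xs → x ∉ xs → (x ∈ᵇ xs) ≡ false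
  ∈ᵇ-false []       _  = refl
  ∈ᵇ-false (y ∷ ys) x∉ rewrite ==-≢ (x∉ ∘ here) = ∈ᵇ-false ys (x∉ ∘ there)

  ∈ᵇ-filter : (q : A → Bool) {x : A} → q x ≡ true → (xs : List A) →
              (x ∈ᵇ filter (holds? q) xs) ≡ (x ∈ᵇ xs)
  ∈ᵇ-filter q h []       = refl
  ∈ᵇ-filter q {x} h (y ∷ ys) with q y in qy
  ... | true  = cong ((x == y) ∨_) (∈ᵇ-filter q h ys)
  ... | false with x ≟ y
  ...   | yes refl = ⊥-elim (true≢false (trans (sym h) qy))
  ...   | no _     = ∈ᵇ-filter q h ys

  before : A → List A → List A
  before e = takeWhile (λ x → ¬? (x ≟ e))

  before-hit : ∀ e σ → before e (e ∷ σ) ≡ []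
  before-hit e σ rewrite dec-true (e ≟ e) refl = refl

  before-miss : ∀ {e z} σ → z ≢ e → before e (z ∷ σ) ≡ z ∷ before e σ
  before-miss {e} {z} σ z≢e rewrite dec-false (z ≟ e) z≢e = refl

  ∈-before⁻ : ∀ e {x} ω → x ∈ before e ω → x ∈ ω × x ≢ e
  ∈-before⁻ e (z ∷ zs) i with z ≟ e
  ∈-before⁻ e (z ∷ zs) (here refl) | no z≢e = here refl , z≢e
  ∈-before⁻ e (z ∷ zs) (there i)   | no _   = let (j , x≢e) = ∈-before⁻ e zs i in there j , x≢e

  Unique-before : ∀ e ω → Unique ω → Unique (before e ω)
  Unique-before e []       _        = []
  Unique-before e (z ∷ zs) (pz ∷ u) with z ≟ e
  ... | yes _ = []
  ... | no _  = All.tabulate (All.lookup pz ∘ proj₁ ∘ ∈-before⁻ e zs) ∷ Unique-before e zs u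

  before-split : ∀ e ω → e ∈ ω → ∃ λ Q → ω ≡ before e ω ++ e ∷ Q
  before-split e (z ∷ zs) i with z ≟ e
  ... | yes refl = zs , refl
  before-split e (z ∷ zs) (here refl) | no z≢e = ⊥-elim (z≢e refl)
  before-split e (z ∷ zs) (there i)   | no _   = let (Q , eq) = before-split e zs i in Q , cong (z ∷_) eq

  before-++-∈ : ∀ e P R → e ∈ P → before e (P ++ R) ≡ before e P
  before-++-∈ e (z ∷ zs) R i with z ≟ e
  ... | yes refl = refl
  before-++-∈ e (z ∷ zs) R (here refl) | no z≢e = ⊥-elim (z≢e refl)
  before-++-∈ e (z ∷ zs) R (there i)   | no _   = cong (z ∷_) (before-++-∈ e zs R i)

  before-++-∉ : ∀ e P R → e ∉ P → before e (P ++ e ∷ R) ≡ P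
  before-++-∉ e []       R _  = before-hit e R
  before-++-∉ e (z ∷ zs) R e∉ with z ≟ e
  ... | yes refl = ⊥-elim (e∉ (here refl))
  ... | no _     = cong (z ∷_) (before-++-∉ e zs R (e∉ ∘ there))

  before-filter : (q : A → Bool) (e : A) → q e ≡ true → (ω : List A) →
                  before e (filter (holds? q) ω) ≡ filter (holds? q) (before e ω)
  before-filter q e h []       = refl
  before-filter q e h (x ∷ xs) with x ≟ e
  ... | yes refl rewrite h | before-hit x (filter (holds? q) xs) = refl
  ... | no x≢e with q x
  ...   | true  rewrite before-miss (filter (holds? q) xs) x≢e = cong (x ∷_) (before-filter q e h xs)
  ...   | false = before-filter q e h xs

  between : List A → A → List A → List A → Bool
  between X e Y ω = all (_∈ᵇ before e ω) X ∧ all (λ y → not (y ∈ᵇ before e ω)) Y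

  between-filter : (q : A → Bool) (X : List A) (e : A) (Y : List A) →
                   (∀ {z} → z ∈ Y ++ X ++ [ e ] → q z ≡ true) →
                   ∀ ω → between X e Y (filter (holds? q) ω) ≡ between X e Y ω
  between-filter q X e Y q-true ω rewrite before-filter q e (q-true (∈-++⁺ʳ Y (∈-++⁺ʳ X (here refl)))) ω =
    cong₂ _∧_ (all-cong-∈ X (λ i → ∈ᵇ-filter q (q-true (∈-++⁺ʳ Y (∈-++⁺ˡ i))) (before e ω)))
              (all-cong-∈ Y (λ i → cong not (∈ᵇ-filter q (q-true (∈-++⁺ˡ i)) (before e ω))))

  insertions-∈ᵇ-before : ∀ {y e w} → y ≢ e → w ≢ y → ∀ τ {σ} → σ ∈ insertions y τ →
                         (w ∈ᵇ before e σ) ≡ (w ∈ᵇ before e τ)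
  insertions-∈ᵇ-before y≢e w≢y [] (here refl) rewrite before-miss [] y≢e | ==-≢ w≢y = refl
  insertions-∈ᵇ-before y≢e w≢y (z ∷ zs) (here refl) rewrite before-miss (z ∷ zs) y≢e | ==-≢ w≢y = refl
  insertions-∈ᵇ-before {e = e} {w} y≢e w≢y (z ∷ zs) (there i) with ∈-map⁻ (z ∷_) i
  ... | σ , j , refl with z ≟ e
  ...   | yes refl = refl
  ...   | no _     = cong ((w == z) ∨_) (insertions-∈ᵇ-before y≢e w≢y zs j)

  between-insertions : ∀ {y e} X Y → y ≢ e → (∀ {w} → w ∈ X → w ≢ y) → (∀ {w} → w ∈ Y → w ≢ y) →
                       ∀ τ {σ} → σ ∈ insertions y τ → between X e Y σ ≡ between X e Y τ
  between-insertions X Y y≢e X≢y Y≢y τ i =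
    cong₂ _∧_ (all-cong-∈ X (λ j → insertions-∈ᵇ-before y≢e (X≢y j) τ i))
              (all-cong-∈ Y (λ j → cong not (insertions-∈ᵇ-before y≢e (Y≢y j) τ i)))

  -- Inserting y into τ puts it before e at exactly the positions up to that of e.
  count-insertions-before : ∀ {y e} → y ≢ e → ∀ τ → y ∉ τ →
    ∑ (λ σ → 𝟙 (y ∈ᵇ before e σ)) (insertions y τ) ≡ suc (length (before e τ))
  count-insertions-before {y} {e} y≢e [] _ rewrite before-miss [] y≢e | ==-refl y = refl
  count-insertions-before {y} {e} y≢e (z ∷ zs) y∉ = begin
    𝟙 (y ∈ᵇ before e (y ∷ z ∷ zs)) + ∑ f (map (z ∷_) (insertions y zs))
      ≡⟨ cong₂ _+_ first (∑-map f (z ∷_) (insertions y zs)) ⟩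
    1 + ∑ (f ∘ (z ∷_)) (insertions y zs) ≡⟨ cong suc rest ⟩
    suc (length (before e (z ∷ zs)))     ∎
    where
    open ≡-Reasoning
    f : List A → ℕ
    f σ = 𝟙 (y ∈ᵇ before e σ)
    first : 𝟙 (y ∈ᵇ before e (y ∷ z ∷ zs)) ≡ 1
    first rewrite before-miss (z ∷ zs) y≢e | ==-refl y = refl
    rest : ∑ (f ∘ (z ∷_)) (insertions y zs) ≡ length (before e (z ∷ zs))
    rest with z ≟ e
    ... | yes refl = ∑-zero (insertions y zs) (λ σ → refl)
    ... | no _ = trans (∑-cong (insertions y zs) (λ σ → cong (λ b → 𝟙 (b ∨ (y ∈ᵇ before e σ))) (==-≢ (y∉ ∘ here))))
                       (count-insertions-before y≢e zs (y∉ ∘ there))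

  count-insertions-not-before : ∀ {y e} → y ≢ e → ∀ τ → y ∉ τ →
    ∑ (λ σ → 𝟙 (not (y ∈ᵇ before e σ))) (insertions y τ) + length (before e τ) ≡ length τ
  count-insertions-not-before {y} {e} y≢e τ y∉ = +-cancelˡ-≡ 1 _ _ (begin
    1 + (∑ g σs + length (before e τ)) ≡⟨ cong suc (+-comm (∑ g σs) _) ⟩
    1 + length (before e τ) + ∑ g σs   ≡⟨ cong (_+ ∑ g σs) (sym (count-insertions-before y≢e τ y∉)) ⟩
    ∑ f σs + ∑ g σs                    ≡⟨ sym (∑-+ f g σs) ⟩
    ∑ (λ σ → f σ + g σ) σs             ≡⟨ ∑-cong σs (λ σ → 𝟙-not (y ∈ᵇ before e σ)) ⟩
    ∑ (λ _ → 1) σs                     ≡⟨ trans (∑-const 1 σs) (*-identityʳ _) ⟩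
    length σs                          ≡⟨ length-insertions y τ ⟩
    1 + length τ                       ∎)
    where
    open ≡-Reasoning
    σs = insertions y τ
    f g : List A → ℕ
    f σ = 𝟙 (y ∈ᵇ before e σ)
    g σ = 𝟙 (not (y ∈ᵇ before e σ))

  length-before : ∀ X e Y τ → Unique τ → Unique X → τ ↭ Y ++ X ++ [ e ] → between X e Y τ ≡ true →
                  length (before e τ) ≡ length X
  length-before X e Y τ uτ uX τ↭ h =
    ↭-length (Unique-same-elements⇒↭ (Unique-before e τ uτ) uX to from)
    where
    hX = proj₁ (∧-true⁻ h)
    hY = proj₂ (∧-true⁻ {a = all (_∈ᵇ before e τ) X} h)
    to : ∀ {z} → z ∈ before e τ → z ∈ X
    to i with ∈-before⁻ e τ i
    ... | zτ , z≢e with ∈-++⁻ Y (∈-resp-↭ τ↭ zτ)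
    ...   | inj₁ zY = ⊥-elim (true≢false (trans (sym (∈ᵇ-complete i)) (not-true⁻ (all-sound _ hY zY))))
    ...   | inj₂ zXe with ∈-++⁻ X zXe
    ...     | inj₁ zX = zX
    ...     | inj₂ (here z≡e) = ⊥-elim (z≢e z≡e)
    from : ∀ {z} → z ∈ X → z ∈ before e τ
    from i = ∈ᵇ-sound (before e τ) (all-sound _ hX i)

  count-between-[] : ∀ X e → Unique (X ++ [ e ]) →
    ∑ (𝟙 ∘ between X e []) (orderings (X ++ [ e ])) ≡ (length X) !
  count-between-[] []      e _        = refl
  count-between-[] (x ∷ X) e (px ∷ u) = begin
    ∑ (𝟙 ∘ between (x ∷ X) e []) (orderings (x ∷ X ++ [ e ]))
      ≡⟨ ∑-orderings-∷ _ _ (suc (length X)) x (X ++ [ e ]) step ⟩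
    suc (length X) * ∑ (𝟙 ∘ between X e []) (orderings (X ++ [ e ]))
      ≡⟨ cong (suc (length X) *_) (count-between-[] X e u) ⟩
    suc (length X) * (length X) ! ∎
    where
    open ≡-Reasoning
    x∉ : x ∉ X ++ [ e ]
    x∉ = Unique[x∷xs]⇒x∉xs (px ∷ u)
    x≢e : x ≢ e
    x≢e = x∉ ∘ ∈-++⁺ʳ X ∘ here
    X≢x : ∀ {w} → w ∈ X → w ≢ x
    X≢x i = ≢-sym (All.lookup px (∈-++⁺ˡ i))
    step : ∀ {τ} → τ ↭ X ++ [ e ] →
           ∑ (𝟙 ∘ between (x ∷ X) e []) (insertions x τ) ≡ suc (length X) * 𝟙 (between X e [] τ)
    step {τ} τ↭ = begin
      ∑ (𝟙 ∘ between (x ∷ X) e []) (insertions x τ)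
        ≡⟨ ∑-cong-∈ (insertions x τ) split ⟩
      ∑ (λ σ → 𝟙 (x ∈ᵇ before e σ) * 𝟙 (between X e [] τ)) (insertions x τ)
        ≡⟨ ∑-*ʳ (λ σ → 𝟙 (x ∈ᵇ before e σ)) _ (insertions x τ) ⟩
      ∑ (λ σ → 𝟙 (x ∈ᵇ before e σ)) (insertions x τ) * 𝟙 (between X e [] τ)
        ≡⟨ cong (_* 𝟙 (between X e [] τ)) (count-insertions-before x≢e τ (x∉ ∘ ∈-resp-↭ τ↭)) ⟩
      suc (length (before e τ)) * 𝟙 (between X e [] τ)
        ≡⟨ *𝟙-cong _ _ _ (cong suc ∘ length-before X e [] τ (Unique-↭ (↭-sym τ↭) u) (Unique-++ˡ X u) τ↭) ⟩
      suc (length X) * 𝟙 (between X e [] τ) ∎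
      where
      split : ∀ {σ} → σ ∈ insertions x τ →
              𝟙 (between (x ∷ X) e [] σ) ≡ 𝟙 (x ∈ᵇ before e σ) * 𝟙 (between X e [] τ)
      split {σ} i = trans (cong 𝟙 (trans (Boolₚ.∧-assoc (x ∈ᵇ before e σ) _ _)
                                        (cong ((x ∈ᵇ before e σ) ∧_) (between-insertions X [] x≢e X≢x (λ ()) τ i))))
                          (𝟙-∧ (x ∈ᵇ before e σ) (between X e [] τ))

  count-between-exact : ∀ X e Y → Unique (Y ++ X ++ [ e ]) →
    ∑ (𝟙 ∘ between X e Y) (orderings (Y ++ X ++ [ e ])) ≡ (length X) ! * (length Y) !
  count-between-exact X e []      u        = trans (count-between-[] X e u) (sym (*-identityʳ _))
  count-between-exact X e (y ∷ Y) (py ∷ u) = begin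
    ∑ (𝟙 ∘ between X e (y ∷ Y)) (orderings (y ∷ T))
      ≡⟨ ∑-orderings-∷ _ _ (suc (length Y)) y T step ⟩
    suc (length Y) * ∑ (𝟙 ∘ between X e Y) (orderings T)
      ≡⟨ cong (suc (length Y) *_) (count-between-exact X e Y u) ⟩
    suc (length Y) * ((length X) ! * (length Y) !)
      ≡⟨ m*[n*o]≡n*[m*o] (suc (length Y)) ((length X) !) ((length Y) !) ⟩
    (length X) ! * suc (length Y) ! ∎
    where
    open ≡-Reasoning
    T = Y ++ X ++ [ e ]
    y∉ : y ∉ T
    y∉ = Unique[x∷xs]⇒x∉xs (py ∷ u)
    y≢e : y ≢ e
    y≢e = y∉ ∘ ∈-++⁺ʳ Y ∘ ∈-++⁺ʳ X ∘ here
    X≢y : ∀ {w} → w ∈ X → w ≢ y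
    X≢y i = ≢-sym (All.lookup py (∈-++⁺ʳ Y (∈-++⁺ˡ i)))
    Y≢y : ∀ {w} → w ∈ Y → w ≢ y
    Y≢y i = ≢-sym (All.lookup py (∈-++⁺ˡ i))
    length-T : length T ≡ suc (length Y) + length X
    length-T = trans (length-++ Y) (trans (cong (_+_ (length Y)) (trans (length-++ X) (+-comm (length X) 1)))
                                          (+-suc (length Y) (length X)))
    step : ∀ {τ} → τ ↭ T → ∑ (𝟙 ∘ between X e (y ∷ Y)) (insertions y τ) ≡ suc (length Y) * 𝟙 (between X e Y τ)
    step {τ} τ↭ = begin
      ∑ (𝟙 ∘ between X e (y ∷ Y)) (insertions y τ)
        ≡⟨ ∑-cong-∈ (insertions y τ) split ⟩
      ∑ (λ σ → 𝟙 (not (y ∈ᵇ before e σ)) * 𝟙 (between X e Y τ)) (insertions y τ)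
        ≡⟨ ∑-*ʳ (λ σ → 𝟙 (not (y ∈ᵇ before e σ))) _ (insertions y τ) ⟩
      ∑ (λ σ → 𝟙 (not (y ∈ᵇ before e σ))) (insertions y τ) * 𝟙 (between X e Y τ)
        ≡⟨ *𝟙-cong _ _ _ count ⟩
      suc (length Y) * 𝟙 (between X e Y τ) ∎
      where
      split : ∀ {σ} → σ ∈ insertions y τ →
              𝟙 (between X e (y ∷ Y) σ) ≡ 𝟙 (not (y ∈ᵇ before e σ)) * 𝟙 (between X e Y τ)
      split {σ} i = trans (cong 𝟙 (trans (∧-leftComm (all (_∈ᵇ before e σ) X) (not (y ∈ᵇ before e σ)) _)
                                        (cong (not (y ∈ᵇ before e σ) ∧_) (between-insertions X Y y≢e X≢y Y≢y τ i))))
                          (𝟙-∧ (not (y ∈ᵇ before e σ)) (between X e Y τ))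
      count : between X e Y τ ≡ true → ∑ (λ σ → 𝟙 (not (y ∈ᵇ before e σ))) (insertions y τ) ≡ suc (length Y)
      count h = +-cancelʳ-≡ (length X) _ _ (begin
        ∑ (λ σ → 𝟙 (not (y ∈ᵇ before e σ))) (insertions y τ) + length X
          ≡⟨ cong (_+_ _) (sym (length-before X e Y τ (Unique-↭ (↭-sym τ↭) u) (Unique-++ˡ X (Unique-++ʳ Y u)) τ↭ h)) ⟩
        ∑ (λ σ → 𝟙 (not (y ∈ᵇ before e σ))) (insertions y τ) + length (before e τ)
          ≡⟨ count-insertions-not-before y≢e τ (y∉ ∘ ∈-resp-↭ τ↭) ⟩
        length τ ≡⟨ trans (↭-length τ↭) length-T ⟩
        suc (length Y) + length X ∎)

  -- Only the relative order of the elements of T = Y ++ X ++ [ e ] matters, and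
  -- each ordering of T extends to |E|! / |T|! orderings of E.
  count-between : ∀ E X e Y → Unique E → Unique (Y ++ X ++ [ e ]) → (∀ {z} → z ∈ Y ++ X ++ [ e ] → z ∈ E) →
    ∑ (𝟙 ∘ between X e Y) (orderings E) * suc (length X + length Y) ! ≡ (length E) ! * ((length X) ! * (length Y) !)
  count-between E X e Y uE uT T⊆E = begin
    ∑ p (orderings E) * suc (length X + length Y) !
      ≡⟨ cong₂ _*_ (∑-↭ p (orderings-resp-↭ E↭)) (cong _! length-T) ⟩
    ∑ p (orderings (R ++ T)) * (length T) !
      ≡⟨ cong (_* (length T) !) (∑-cong (orderings (R ++ T)) (cong 𝟙 ∘ sym ∘ between-filter q X e Y q-true)) ⟩
    ∑ (p ∘ filter (holds? q)) (orderings (R ++ T)) * (length T) !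
      ≡⟨ ∑-orderings-++-rejected q p R T R-false ⟩
    (length R + length T) ! * ∑ (p ∘ filter (holds? q)) (orderings T)
      ≡⟨ cong₂ _*_ (cong _! (trans (sym (length-++ R)) (sym (↭-length E↭))))
                   (∑-cong (orderings T) (cong 𝟙 ∘ between-filter q X e Y q-true)) ⟩
    (length E) ! * ∑ p (orderings T)
      ≡⟨ cong ((length E) ! *_) (count-between-exact X e Y uT) ⟩
    (length E) ! * ((length X) ! * (length Y) !) ∎
    where
    open ≡-Reasoning
    T = Y ++ X ++ [ e ]
    p = 𝟙 ∘ between X e Y
    q : A → Bool
    q = _∈ᵇ T
    R = filter (holds? (not ∘ q)) E
    q-true : ∀ {z} → z ∈ T → q z ≡ true
    q-true = ∈ᵇ-complete
    R-false : All (λ r → q r ≡ false) R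
    R-false = All.tabulate (not-true⁻ ∘ proj₂ ∘ ∈-filter⁻ (holds? (not ∘ q)) {xs = E})
    E↭ : E ↭ R ++ T
    E↭ = ↭-trans (filter-partition-↭ q E) (++⁺ˡ R (Unique-same-elements⇒↭ (filter⁺ (holds? q) uE) uT
           (λ i → ∈ᵇ-sound T (proj₂ (∈-filter⁻ (holds? q) {xs = E} i)))
           (λ i → ∈-filter⁺ (holds? q) (T⊆E i) (q-true i))))
    length-T : suc (length X + length Y) ≡ length T
    length-T = sym (trans (length-++ Y) (trans (cong (_+_ (length Y)) (trans (length-++ X) (+-comm (length X) 1)))
                   (trans (+-suc (length Y) (length X)) (cong suc (+-comm (length Y) (length X))))))

  ∑-𝟙-== : (g : A → ℕ) {xs : List A} {w : A} → Unique xs → w ∈ xs → ∑ (λ a → 𝟙 (a == w) * g a) xs ≡ g w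
  ∑-𝟙-== g {x ∷ xs} (px ∷ u) (here refl) rewrite ==-refl x =
    trans (cong₂ _+_ (+-identityʳ (g x)) (∑-zero xs (λ i → cong (λ b → 𝟙 b * g _) (==-≢ (≢-sym (All.lookup px i))))))
          (+-identityʳ (g x))
  ∑-𝟙-== g {x ∷ xs} {w} (px ∷ u) (there i) rewrite ==-≢ (All.lookup px i) = ∑-𝟙-== g u i

  without : A → List A → List A
  without e = filter (λ f → ¬? (f ≟ e))

  length-without : ∀ {e xs} → Unique xs → e ∈ xs → suc (length (without e xs)) ≡ length xs
  length-without {e} {x ∷ xs} (px ∷ u) (here refl) rewrite dec-true (x ≟ x) refl =
    cong (suc ∘ length) (filter-all (λ f → ¬? (f ≟ x)) (All.map ≢-sym px))
  length-without {e} {x ∷ xs} (px ∷ u) (there i) rewrite dec-false (x ≟ e) (All.lookup px i) =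
    cong suc (length-without u i)

  isLast : List A → List A → A → Bool
  isLast M ω e = all (_∈ᵇ before e ω) (without e M)

  last-split : ∀ (M ω : List A) → (∃ λ f → f ∈ M × f ∈ ω) →
               ∃ λ P → ∃ λ z → ∃ λ Q → ω ≡ P ++ z ∷ Q × z ∈ M × (∀ {f} → f ∈ M → f ∉ Q)
  last-split M (y ∷ ys) (f , fM , fω) with any (_∈ᵇ M) ys in eq
  ... | true  = let (g , gys , gM) = any-sound _ ys eq
                    (P , z , Q , ys≡ , zM , Q∌M) = last-split M ys (g , ∈ᵇ-sound M gM , gys)
                in y ∷ P , z , Q , cong (y ∷_) ys≡ , zM , Q∌M
  ... | false = [] , y , ys , refl , yM fω , λ gM gys → true≢false (trans (sym (any-complete _ gys (∈ᵇ-complete gM))) eq)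
    where
    yM : f ∈ y ∷ ys → y ∈ M
    yM (here refl) = fM
    yM (there i)   = ⊥-elim (true≢false (trans (sym (any-complete _ i (∈ᵇ-complete fM))) eq))

  ∑-isLast : ∀ {M ω} → Unique ω → Unique M → (∀ {z} → z ∈ M → z ∈ ω) → ∀ {e₀} → e₀ ∈ M →
             ∑ (𝟙 ∘ isLast M ω) M ≡ 1
  ∑-isLast {M} {ω} uω uM M⊆ω {e₀} e₀∈M with last-split M ω (e₀ , e₀∈M , M⊆ω e₀∈M)
  ... | P , z , Q , refl , z∈M , Q∌M = trans (∑-cong-∈ M value) (∑-𝟙-== (λ _ → 1) uM z∈M)
    where
    z∉P : z ∉ P
    z∉P = Unique-middle P uω
    M-in-P : ∀ {f} → f ∈ M → f ≢ z → f ∈ P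
    M-in-P {f} f∈M f≢z with ∈-++⁻ P (M⊆ω f∈M)
    ... | inj₁ f∈P           = f∈P
    ... | inj₂ (here f≡z)    = ⊥-elim (f≢z f≡z)
    ... | inj₂ (there f∈Q)   = ⊥-elim (Q∌M f∈M f∈Q)
    value : ∀ {e} → e ∈ M → 𝟙 (isLast M (P ++ z ∷ Q) e) ≡ 𝟙 (e == z) * 1
    value {e} e∈M with e ≟ z
    ... | yes refl rewrite before-++-∉ e P Q z∉P =
      cong 𝟙 (all-complete _ (without e M) (λ i → let (f∈M , f≢e) = ∈-filter⁻ (λ f → ¬? (f ≟ e)) {xs = M} i
                                                    in ∈ᵇ-complete (M-in-P f∈M f≢e)))
    ... | no e≢z rewrite before-++-∈ e P (z ∷ Q) (M-in-P e∈M e≢z) =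
      cong 𝟙 (all-false _ (∈-filter⁺ (λ f → ¬? (f ≟ e)) z∈M (e≢z ∘ sym))
                          (∈ᵇ-false (before e P) (z∉P ∘ proj₁ ∘ ∈-before⁻ e P)))

  _⊆ᵇ_ : List A → List A → Bool
  M ⊆ᵇ H = all (_∈ᵇ H) M

  ∑-sublists-⊆ᵇ : (Q : List A → Bool) (H E : List A) →
    ∑ (λ M → 𝟙 (Q M) * 𝟙 (M ⊆ᵇ H)) (sublists E) ≡ ∑ (𝟙 ∘ Q) (sublists (filter (holds? (_∈ᵇ H)) E))
  ∑-sublists-⊆ᵇ Q H [] = cong (_+ 0) (*-identityʳ (𝟙 (Q [])))
  ∑-sublists-⊆ᵇ Q H (x ∷ xs) with x ∈ᵇ H in x∈H
  ... | true = begin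
    ∑ g (sublists (x ∷ xs))                              ≡⟨ ∑-sublists-∷ g x xs ⟩
    ∑ (g ∘ (x ∷_)) S + ∑ g S                             ≡⟨ cong (_+ ∑ g S) (∑-cong S x∷M⊆H) ⟩
    ∑ (λ M → 𝟙 (Q (x ∷ M)) * 𝟙 (M ⊆ᵇ H)) S + ∑ g S      ≡⟨ cong₂ _+_ (∑-sublists-⊆ᵇ (Q ∘ (x ∷_)) H xs) (∑-sublists-⊆ᵇ Q H xs) ⟩
    ∑ (𝟙 ∘ Q ∘ (x ∷_)) S′ + ∑ (𝟙 ∘ Q) S′                 ≡⟨ sym (∑-sublists-∷ (𝟙 ∘ Q) x (filter (holds? (_∈ᵇ H)) xs)) ⟩
    ∑ (𝟙 ∘ Q) (sublists (x ∷ filter (holds? (_∈ᵇ H)) xs)) ∎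
    where
    open ≡-Reasoning
    g = λ M → 𝟙 (Q M) * 𝟙 (M ⊆ᵇ H)
    S = sublists xs
    S′ = sublists (filter (holds? (_∈ᵇ H)) xs)
    x∷M⊆H : ∀ M → g (x ∷ M) ≡ 𝟙 (Q (x ∷ M)) * 𝟙 (M ⊆ᵇ H)
    x∷M⊆H M = cong (λ b → 𝟙 (Q (x ∷ M)) * 𝟙 (b ∧ (M ⊆ᵇ H))) x∈H
  ... | false = begin
    ∑ g (sublists (x ∷ xs))     ≡⟨ ∑-sublists-∷ g x xs ⟩
    ∑ (g ∘ (x ∷_)) S + ∑ g S    ≡⟨ cong (_+ ∑ g S) (∑-zero S x∷M⊈H) ⟩
    ∑ g S                       ≡⟨ ∑-sublists-⊆ᵇ Q H xs ⟩
    ∑ (𝟙 ∘ Q) S′                ∎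
    where
    open ≡-Reasoning
    g = λ M → 𝟙 (Q M) * 𝟙 (M ⊆ᵇ H)
    S = sublists xs
    S′ = sublists (filter (holds? (_∈ᵇ H)) xs)
    x∷M⊈H : ∀ {M} → M ∈ S → g (x ∷ M) ≡ 0
    x∷M⊈H {M} _ = trans (cong (λ b → 𝟙 (Q (x ∷ M)) * 𝟙 (b ∧ (M ⊆ᵇ H))) x∈H) (*-zeroʳ (𝟙 (Q (x ∷ M))))

  ∑-sublists-restrict : (Q : List A → Bool) → (∀ {M M′} → M ↭ M′ → Q M ≡ Q M′) →
    ∀ {H E} → Unique H → Unique E → (∀ {z} → z ∈ H → z ∈ E) →
    ∑ (𝟙 ∘ Q) (sublists H) ≡ ∑ (λ M → 𝟙 (Q M) * 𝟙 (M ⊆ᵇ H)) (sublists E)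
  ∑-sublists-restrict Q Q-inv {H} {E} uH uE H⊆E =
    trans (∑-sublists-↭ (𝟙 ∘ Q) (cong 𝟙 ∘ Q-inv) (↭-sym E∩H↭H)) (sym (∑-sublists-⊆ᵇ Q H E))
    where
    E∩H↭H : filter (holds? (_∈ᵇ H)) E ↭ H
    E∩H↭H = Unique-same-elements⇒↭ (filter⁺ (holds? (_∈ᵇ H)) uE) uH
              (λ i → ∈ᵇ-sound H (proj₂ (∈-filter⁻ (holds? (_∈ᵇ H)) {xs = E} i)))
              (λ i → ∈-filter⁺ (holds? (_∈ᵇ H)) (H⊆E i) (∈ᵇ-complete i))

-- Edges, degrees and perfect matchings of G

module Graph {m : ℕ} (G : SimpleGraph m) where

  _≟ₑ_ : DecidableEquality (Edge m)
  _≟ₑ_ = ≡-dec Finₚ._≟_ Finₚ._≟_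

  open Arrangements _≟ₑ_ public
  module Vert = Arrangements (Finₚ._≟_ {m})

  V : List (Fin m)
  V = allFin m

  E : List (Edge m)
  E = edges G

  _<ᵇ_ : Fin m → Fin m → Bool
  a <ᵇ b = does (a <? b)

  private
    edgesFrom : Fin m → List (Edge m)
    edgesFrom a = map (a ,_) (filter (a <?_) (filter (holds? (Adj G a)) V))

    ∈-edgesFrom⁻ : ∀ {a f} → f ∈ edgesFrom a → proj₁ f ≡ a
    ∈-edgesFrom⁻ {a} i with ∈-map⁻ (a ,_) i
    ... | _ , _ , refl = refl

  ∈-edges⁻ : ∀ {a b} → (a , b) ∈ E → a <ᶠ b × Adj G a b ≡ true
  ∈-edges⁻ i with find (∈-concatMap⁻ edgesFrom {xs = V} i)
  ... | a , _ , j with ∈-map⁻ (a ,_) j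
  ... | b , k , refl with ∈-filter⁻ (a <?_) k
  ... | k′ , a<b = a<b , proj₂ (∈-filter⁻ (holds? (Adj G a)) {xs = V} k′)

  edges-unique : Unique E
  edges-unique = Uniqueₚ.concat⁺ (Allₚ.map⁺ (All.tabulate (λ _ → edgesFrom-unique)))
                                 (AllPairsₚ.map⁺ (AllPairs.map edgesFrom-disjoint (Uniqueₚ.allFin⁺ m)))
    where
    edgesFrom-unique : ∀ {a} → Unique (edgesFrom a)
    edgesFrom-unique = Uniqueₚ.map⁺ ,-injectiveʳ (Uniqueₚ.filter⁺ _ (Uniqueₚ.filter⁺ _ (Uniqueₚ.allFin⁺ m)))
    edgesFrom-disjoint : ∀ {a a′} → a ≢ a′ → Disjoint (edgesFrom a) (edgesFrom a′)
    edgesFrom-disjoint a≢a′ (i , j) = a≢a′ (trans (sym (∈-edgesFrom⁻ i)) (∈-edgesFrom⁻ j))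

  ∑-edges : (g : Edge m → ℕ) → ∑ g E ≡ ∑ (λ a → ∑ (λ b → 𝟙 (Adj G a b) * (𝟙 (a <ᵇ b) * g (a , b))) V) V
  ∑-edges g = trans (∑-concatMap g edgesFrom V) (∑-cong V λ a →
    trans (∑-map g (a ,_) (filter (a <?_) (filter (holds? (Adj G a)) V)))
    (trans (∑-filter (a <?_) (g ∘ (a ,_)) (filter (holds? (Adj G a)) V))
    (trans (∑-filter (holds? (Adj G a)) _ V)
           (∑-cong V (λ b → cong (λ t → 𝟙 t * (𝟙 (a <ᵇ b) * g (a , b))) (does-holds (Adj G a) b))))))

  incident⁻ : ∀ {w a b : Fin m} → incident w (a , b) ≡ true → w ≡ a ⊎ w ≡ b
  incident⁻ {w} {a} {b} h with w Finₚ.≟ a | w Finₚ.≟ b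
  ... | yes w≡a | _       = inj₁ w≡a
  ... | no _    | yes w≡b = inj₂ w≡b

  incident-fst : ∀ (a b : Fin m) → incident a (a , b) ≡ true
  incident-fst a b with a Finₚ.≟ a
  ... | yes _   = refl
  ... | no a≢a = ⊥-elim (a≢a refl)

  incident-snd : ∀ (a b : Fin m) → incident b (a , b) ≡ true
  incident-snd a b with b Finₚ.≟ a | b Finₚ.≟ b
  ... | yes _ | _       = refl
  ... | no _  | yes _   = refl
  ... | no _  | no b≢b = ⊥-elim (b≢b refl)

  incident-split : ∀ w {a b} → a ≢ b → 𝟙 (incident w (a , b)) ≡ 𝟙 (w Vert.== a) + 𝟙 (w Vert.== b)
  incident-split w {a} {b} a≢b =
    trans (cong 𝟙 (cong₂ _∨_ (isYes≗does (w Finₚ.≟ a)) (isYes≗does (w Finₚ.≟ b)))) (𝟙-∨-disjoint (w Vert.== a) (w Vert.== b) not-both)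
    where
    not-both : ((w Vert.== a) ∧ (w Vert.== b)) ≡ false
    not-both with w Finₚ.≟ a | w Finₚ.≟ b
    ... | yes refl | yes refl = ⊥-elim (a≢b refl)
    ... | yes _    | no _     = refl
    ... | no _     | _        = refl

  handshake : ∀ M → (∀ {f} → f ∈ M → f ∈ E) → ∑ (λ w → ∑ (𝟙 ∘ incident w) M) V ≡ length M * 2
  handshake M M⊆E = trans (∑-comm (λ w f → 𝟙 (incident w f)) V M) (trans (∑-cong-∈ M two) (∑-const 2 M))
    where
    ∑-at : ∀ c → ∑ (λ w → 𝟙 (w Vert.== c)) V ≡ 1
    ∑-at c = trans (∑-cong V (λ w → sym (*-identityʳ _))) (Vert.∑-𝟙-== (λ _ → 1) (Uniqueₚ.allFin⁺ m) (∈-allFin c))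
    two : ∀ {f} → f ∈ M → ∑ (λ w → 𝟙 (incident w f)) V ≡ 2
    two {a , b} i = trans (∑-cong V (λ w → incident-split w (Finₚ.<⇒≢ (proj₁ (∈-edges⁻ (M⊆E i))))))
                          (trans (∑-+ _ _ V) (cong₂ _+_ (∑-at a) (∑-at b)))

  listed : Fin m → Fin m → ℕ
  listed a b = 𝟙 (Adj G a b) * 𝟙 (a <ᵇ b)

  incident-listed : ∀ w a b → 𝟙 (Adj G a b) * (𝟙 (a <ᵇ b) * 𝟙 (incident w (a , b))) ≡
                              𝟙 (a Vert.== w) * listed a b + 𝟙 (b Vert.== w) * listed a b
  incident-listed w a b with a <? b
  ... | no a≮b rewrite dec-false (a <? b) a≮b = absent (𝟙 (Adj G a b)) (𝟙 (a Vert.== w)) (𝟙 (b Vert.== w))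
    where
    absent : ∀ p x y → p * 0 ≡ x * (p * 0) + y * (p * 0)
    absent = solve-∀
  ... | yes a<b rewrite dec-true (a <? b) a<b | incident-split w (Finₚ.<⇒≢ a<b) | Vert.==-sym w a | Vert.==-sym w b =
    present (𝟙 (Adj G a b)) (𝟙 (a Vert.== w)) (𝟙 (b Vert.== w))
    where
    present : ∀ p x y → p * (1 * (x + y)) ≡ x * (p * 1) + y * (p * 1)
    present = solve-∀

  listed-both : ∀ w b → listed w b + listed b w ≡ 𝟙 (Adj G w b)
  listed-both w b rewrite adj-sym G b w with Finₚ.<-cmp w b
  ... | tri≈ _ refl _ rewrite adj-irrefl G w = refl
  ... | tri< w<b _ _ rewrite dec-true (w <? b) w<b | dec-false (b <? w) (Finₚ.<-asym w<b) with Adj G w b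
  ...   | true  = refl
  ...   | false = refl
  listed-both w b | tri> _ _ b<w rewrite dec-false (w <? b) (Finₚ.<-asym b<w) | dec-true (b <? w) b<w with Adj G w b
  ...   | true  = refl
  ...   | false = refl

  ∑-incident≡degree : ∀ w → ∑ (𝟙 ∘ incident w) E ≡ degree G w
  ∑-incident≡degree w = begin
    ∑ (𝟙 ∘ incident w) E
      ≡⟨ ∑-edges (𝟙 ∘ incident w) ⟩
    ∑ (λ a → ∑ (λ b → 𝟙 (Adj G a b) * (𝟙 (a <ᵇ b) * 𝟙 (incident w (a , b)))) V) V
      ≡⟨ ∑-cong V (λ a → trans (∑-cong V (incident-listed w a)) (∑-+ _ _ V)) ⟩
    ∑ (λ a → ∑ (λ b → 𝟙 (a Vert.== w) * listed a b) V + ∑ (λ b → 𝟙 (b Vert.== w) * listed a b) V) V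
      ≡⟨ ∑-+ _ _ V ⟩
    ∑ (λ a → ∑ (λ b → 𝟙 (a Vert.== w) * listed a b) V) V + ∑ (λ a → ∑ (λ b → 𝟙 (b Vert.== w) * listed a b) V) V
      ≡⟨ cong₂ _+_ from-w to-w ⟩
    ∑ (listed w) V + ∑ (λ a → listed a w) V
      ≡⟨ sym (∑-+ _ _ V) ⟩
    ∑ (λ b → listed w b + listed b w) V
      ≡⟨ ∑-cong V (listed-both w) ⟩
    ∑ (𝟙 ∘ Adj G w) V
      ≡⟨ sym (length-filter-holds (Adj G w) V) ⟩
    degree G w ∎
    where
    open ≡-Reasoning
    ∑-at-w : (g : Fin m → ℕ) → ∑ (λ a → 𝟙 (a Vert.== w) * g a) V ≡ g w
    ∑-at-w g = Vert.∑-𝟙-== g (Uniqueₚ.allFin⁺ m) (∈-allFin w)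
    from-w = trans (∑-cong V (λ a → ∑-*ˡ (𝟙 (a Vert.== w)) (listed a) V)) (∑-at-w (λ a → ∑ (listed a) V))
    to-w = trans (∑-comm (λ a b → 𝟙 (b Vert.== w) * listed a b) V V)
                 (trans (∑-cong V (λ b → ∑-*ˡ (𝟙 (b Vert.== w)) (λ a → listed a b) V)) (∑-at-w (λ b → ∑ (λ a → listed a b) V)))

  degIn-pm : ∀ M → isPerfectMatching {m} M ≡ true → ∀ w → degIn M w ≡ 1
  degIn-pm M pm w with degIn M w ℕ.≟ 1 | all-sound (λ v → isYes (degIn M v ℕ.≟ 1)) pm (∈-allFin w)
  ... | yes d≡1 | _ = d≡1
  ... | no _    | ()

  length-pm : ∀ M → isPerfectMatching {m} M ≡ true → (∀ {f} → f ∈ M → f ∈ E) → length M * 2 ≡ m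
  length-pm M pm M⊆E = begin
    length M * 2                           ≡⟨ sym (handshake M M⊆E) ⟩
    ∑ (λ w → ∑ (𝟙 ∘ incident w) M) V       ≡⟨ ∑-cong V (λ w → trans (sym (length-filter-holds (incident w) M)) (degIn-pm M pm w)) ⟩
    ∑ (λ _ → 1) V                          ≡⟨ trans (∑-const 1 V) (*-identityʳ _) ⟩
    length V                               ≡⟨ length-tabulate id ⟩
    m                                      ∎
    where open ≡-Reasoning

  pm-covers : ∀ M → isPerfectMatching {m} M ≡ true → ∀ w → ∃ λ f → f ∈ M × incident w f ≡ true
  pm-covers M pm w with filter (holds? (incident w)) M in eq | degIn-pm M pm w
  ... | [] | ()
  ... | f ∷ _ | _ = f , ∈-filter⁻ (holds? (incident w)) {xs = M} (subst (f ∈_) (sym eq) (here refl))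

  pm-incident-unique : ∀ M → isPerfectMatching {m} M ≡ true → ∀ {w e f} → e ∈ M → f ∈ M →
                       incident w e ≡ true → incident w f ≡ true → e ≡ f
  pm-incident-unique M pm {w} e∈M f∈M we wf =
    length≡1⇒≡ (degIn-pm M pm w) (∈-filter⁺ (holds? (incident w)) e∈M we) (∈-filter⁺ (holds? (incident w)) f∈M wf)

  record IsPerfectMatching (M : List (Edge m)) : Set where
    field
      perfect : isPerfectMatching {m} M ≡ true
      unique  : Unique M
      ⊆edges  : ∀ {f} → f ∈ M → f ∈ E

  sublist-matching : ∀ {M} → M ∈ sublists E → isPerfectMatching {m} M ≡ true → IsPerfectMatching M
  sublist-matching i pm = let (uM , M⊆E) = ∈-sublists⁻ edges-unique i in
    record { perfect = pm ; unique = uM ; ⊆edges = M⊆E }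

  some-perfect-matching : 1 ≤ #PM E → ∃ IsPerfectMatching
  some-perfect-matching has-pm with ∑-positive (𝟙 ∘ isPerfectMatching) (sublists E)
                                      (subst (1 ≤_) (length-filter-holds isPerfectMatching (sublists E)) has-pm)
  ... | M , M∈ , pm = M , sublist-matching M∈ (𝟙-positive _ pm)

  degree-positive : 1 ≤ #PM E → ∀ w → 1 ≤ degree G w
  degree-positive has-pm w with some-perfect-matching has-pm
  ... | M , pm with pm-covers M (IsPerfectMatching.perfect pm) w
  ...   | f , f∈M , inc = begin
    1                     ≡⟨ cong 𝟙 (sym inc) ⟩
    𝟙 (incident w f)      ≤⟨ ≤-∑ (𝟙 ∘ incident w) (IsPerfectMatching.⊆edges pm f∈M) ⟩
    ∑ (𝟙 ∘ incident w) E  ≡⟨ ∑-incident≡degree w ⟩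
    degree G w            ∎
    where open ≤-Reasoning

  isPerfectMatching-↭ : ∀ {M M′ : List (Edge m)} → M ↭ M′ → isPerfectMatching {m} M ≡ isPerfectMatching M′
  isPerfectMatching-↭ σ =
    all-cong-∈ V (λ {v} _ → cong (λ k → isYes (k ℕ.≟ 1)) (↭-length (filter-↭ (holds? (incident v)) σ)))

  -- The process G_ω

  covers-++ : ∀ (acc p : List (Edge m)) → coversAll acc ≡ true → coversAll (acc ++ p) ≡ true
  covers-++ acc p h = all-complete _ V (λ {v} i →
    trans (any-++ (incident v) acc p) (cong (_∨ any (incident v) p) (all-sound _ h i)))

  ∈-stopAt⁺ : ∀ (acc l : List (Edge m)) {z} → z ∈ acc → z ∈ stopAt acc l
  ∈-stopAt⁺ acc []       i = i
  ∈-stopAt⁺ acc (e ∷ es) i with coversAll acc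
  ... | true  = i
  ... | false = ∈-stopAt⁺ (acc ∷ʳ e) es (∈-++⁺ˡ i)

  stopAt-covered : ∀ (acc l : List (Edge m)) → coversAll acc ≡ true → stopAt acc l ≡ acc
  stopAt-covered acc []      _ = refl
  stopAt-covered acc (_ ∷ _) h rewrite h = refl

  stopAt-⊆ : ∀ (acc p rest : List (Edge m)) → coversAll (acc ++ p) ≡ true →
             ∀ {z} → z ∈ stopAt acc (p ++ rest) → z ∈ acc ++ p
  stopAt-⊆ acc [] rest h {z} i rewrite ++-identityʳ acc = subst (z ∈_) (stopAt-covered acc rest h) i
  stopAt-⊆ acc (x ∷ p) rest h {z} i with coversAll acc
  ... | true  = ∈-++⁺ˡ i
  ... | false = subst (z ∈_) (++-assoc acc [ x ] p)
                  (stopAt-⊆ (acc ∷ʳ x) p rest (subst (λ t → coversAll t ≡ true) (sym (++-assoc acc [ x ] p)) h) i)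

  stopAt-⊇ : ∀ (acc p : List (Edge m)) e rest → coversAll (acc ++ p) ≡ false →
             ∀ {z} → z ∈ (acc ++ p) ∷ʳ e → z ∈ stopAt acc (p ++ e ∷ rest)
  stopAt-⊇ acc [] e rest h {z} i rewrite ++-identityʳ acc | h = ∈-stopAt⁺ (acc ∷ʳ e) rest i
  stopAt-⊇ acc (x ∷ p) e rest h {z} i with coversAll acc in covered
  ... | true  = ⊥-elim (true≢false (trans (sym (covers-++ acc (x ∷ p) covered)) h))
  ... | false = stopAt-⊇ (acc ∷ʳ x) p e rest (subst (λ t → coversAll t ≡ false) (sym (++-assoc acc [ x ] p)) h)
                  (subst (λ t → z ∈ t ∷ʳ e) (sym (++-assoc acc [ x ] p)) i)

  stopAt-prefix : ∀ (acc ω : List (Edge m)) → ∃ λ P → ∃ λ Q → ω ≡ P ++ Q × stopAt acc ω ≡ acc ++ P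
  stopAt-prefix acc []       = [] , [] , refl , sym (++-identityʳ acc)
  stopAt-prefix acc (e ∷ es) with coversAll acc
  ... | true  = [] , e ∷ es , refl , sym (++-identityʳ acc)
  ... | false = let (P , Q , es≡ , stop≡) = stopAt-prefix (acc ∷ʳ e) es in
                e ∷ P , Q , cong (e ∷_) es≡ , trans stop≡ (++-assoc acc [ e ] P)

  Gω-⊆ : ∀ ω → Unique ω → Unique (Gω ω) × (∀ {z} → z ∈ Gω ω → z ∈ ω)
  Gω-⊆ ω u with stopAt-prefix [] ω
  ... | P , Q , refl , stop≡ rewrite stop≡ = Unique-++ˡ P u , ∈-++⁺ˡ

  -- Everything up to e is added unless the edges before e already cover
  -- every vertex, in which case the process stops before reaching e.
  ⊆ᵇ-Gω : ∀ ω M e → e ∈ M → e ∈ ω → isLast M ω e ≡ true → (M ⊆ᵇ Gω ω) ≡ not (coversAll (before e ω))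
  ⊆ᵇ-Gω ω M e e∈M e∈ω last with before-split e ω e∈ω
  ... | Q , ω≡ = subst (λ t → (M ⊆ᵇ stopAt [] t) ≡ not (coversAll P)) (sym ω≡) cases
    where
    P = before e ω
    e∉P : e ∉ P
    e∉P i = proj₂ (∈-before⁻ e ω i) refl
    M⊆P∷ʳe : ∀ {f} → f ∈ M → f ∈ P ∷ʳ e
    M⊆P∷ʳe {f} f∈M with f ≟ₑ e
    ... | yes refl = ∈-++⁺ʳ P (here refl)
    ... | no f≢e   = ∈-++⁺ˡ (∈ᵇ-sound P (all-sound _ last (∈-filter⁺ (λ f → ¬? (f ≟ₑ e)) f∈M f≢e)))
    cases : (M ⊆ᵇ stopAt [] (P ++ e ∷ Q)) ≡ not (coversAll P)
    cases with coversAll P in covered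
    ... | true  = all-false _ e∈M (∈ᵇ-false _ (e∉P ∘ stopAt-⊆ [] P (e ∷ Q) covered))
    ... | false = all-complete _ M (∈ᵇ-complete ∘ stopAt-⊇ [] P e Q covered ∘ M⊆P∷ʳe)

  othersAt : Fin m → Edge m → List (Edge m)
  othersAt u e = without e (filter (holds? (incident u)) E)

  ∈-othersAt⁻ : ∀ u e {f} → f ∈ othersAt u e → (f ∈ E × incident u f ≡ true) × f ≢ e
  ∈-othersAt⁻ u e i =
    let (j , f≢e) = ∈-filter⁻ (λ f → ¬? (f ≟ₑ e)) {xs = filter (holds? (incident u)) E} i
    in ∈-filter⁻ (holds? (incident u)) {xs = E} j , f≢e

  ∈-othersAt⁺ : ∀ u e {f} → f ∈ E → incident u f ≡ true → f ≢ e → f ∈ othersAt u e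
  ∈-othersAt⁺ u e f∈E inc f≢e = ∈-filter⁺ (λ f → ¬? (f ≟ₑ e)) (∈-filter⁺ (holds? (incident u)) f∈E inc) f≢e

  length-othersAt : ∀ {u e} → e ∈ E → incident u e ≡ true → suc (length (othersAt u e)) ≡ degree G u
  length-othersAt {u} e∈E inc =
    trans (length-without (Uniqueₚ.filter⁺ (holds? (incident u)) edges-unique) (∈-filter⁺ (holds? (incident u)) e∈E inc))
          (trans (length-filter-holds (incident u) E) (∑-incident≡degree u))

  isolatedBefore : Fin m → Edge m → List (Edge m) → Bool
  isolatedBefore u e ω = all (λ f → not (f ∈ᵇ before e ω)) (othersAt u e)

  covered≡not-isolated : ∀ ω u e → ω ↭ E → any (incident u) (before e ω) ≡ not (isolatedBefore u e ω)
  covered≡not-isolated ω u e ω↭E = bool-ext to from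
    where
    to : any (incident u) (before e ω) ≡ true → not (isolatedBefore u e ω) ≡ true
    to h with any-sound (incident u) (before e ω) h
    ... | f , f∈P , inc with ∈-before⁻ e ω f∈P
    ...   | f∈ω , f≢e = cong not (all-false _ (∈-othersAt⁺ u e (∈-resp-↭ ω↭E f∈ω) inc f≢e) (cong not (∈ᵇ-complete f∈P)))
    from : not (isolatedBefore u e ω) ≡ true → any (incident u) (before e ω) ≡ true
    from h with all-false-sound _ (othersAt u e) (not-true⁻ h)
    ... | f , f∈O , f-before =
      any-complete (incident u) {xs = before e ω} (∈ᵇ-sound (before e ω) (not-false⁻ f-before)) (proj₂ (proj₁ (∈-othersAt⁻ u e f∈O)))

  -- Every vertex other than u and v is matched by an edge of M that comes
  -- before the last edge (u , v).
  covers-before-last : ∀ ω M → isPerfectMatching {m} M ≡ true → ∀ u v → isLast M ω (u , v) ≡ true →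
    coversAll (before (u , v) ω) ≡ (any (incident u) (before (u , v) ω) ∧ any (incident v) (before (u , v) ω))
  covers-before-last ω M pm u v last = bool-ext to from
    where
    P = before (u , v) ω
    to : coversAll P ≡ true → (any (incident u) P ∧ any (incident v) P) ≡ true
    to h rewrite all-sound (λ w → any (incident w) P) h (∈-allFin u)
               | all-sound (λ w → any (incident w) P) h (∈-allFin v) = refl
    covered : (any (incident u) P ∧ any (incident v) P) ≡ true → ∀ w → any (incident w) P ≡ true
    covered h w with w Finₚ.≟ u | w Finₚ.≟ v
    ... | yes refl | _        = proj₁ (∧-true⁻ h)
    ... | no _     | yes refl = proj₂ (∧-true⁻ {a = any (incident u) P} h)
    ... | no w≢u   | no w≢v with pm-covers M pm w
    ...   | f , f∈M , inc = any-complete (incident w) (∈ᵇ-sound P (all-sound _ last (∈-filter⁺ _ f∈M f≢e))) inc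
      where
      f≢e : f ≢ (u , v)
      f≢e refl = [ w≢u , w≢v ]′ (incident⁻ inc)
    from : (any (incident u) P ∧ any (incident v) P) ≡ true → coversAll P ≡ true
    from h = all-complete _ V (λ {w} _ → covered h w)

  uncovered-before-last : ∀ ω M → isPerfectMatching {m} M ≡ true → ∀ u v → ω ↭ E → isLast M ω (u , v) ≡ true →
    not (coversAll (before (u , v) ω)) ≡ (isolatedBefore u (u , v) ω ∨ isolatedBefore v (u , v) ω)
  uncovered-before-last ω M pm u v ω↭E last
    rewrite covers-before-last ω M pm u v last
          | covered≡not-isolated ω u (u , v) ω↭E
          | covered≡not-isolated ω v (u , v) ω↭E =
    not-∧-not (isolatedBefore u (u , v) ω) (isolatedBefore v (u , v) ω)

  endpointIsolated : Edge m → List (Edge m) → Bool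
  endpointIsolated e ω = isolatedBefore (proj₁ e) e ω ∨ isolatedBefore (proj₂ e) e ω

  𝟙-⊆ᵇ-Gω : ∀ {M} → IsPerfectMatching M → ∀ {ω} → ω ↭ E → ∀ {e₀} → e₀ ∈ M →
            𝟙 (M ⊆ᵇ Gω ω) ≡ ∑ (λ e → 𝟙 (isLast M ω e ∧ endpointIsolated e ω)) M
  𝟙-⊆ᵇ-Gω {M} pm {ω} ω↭E e₀∈M = sym (begin
    ∑ (λ e → 𝟙 (isLast M ω e ∧ endpointIsolated e ω)) M   ≡⟨ ∑-cong-∈ M (λ {e} i → 𝟙-∧-cong (isLast M ω e) (⊆ᵇ-iff e i)) ⟩
    ∑ (λ e → 𝟙 (isLast M ω e) * 𝟙 (M ⊆ᵇ Gω ω)) M          ≡⟨ ∑-*ʳ (𝟙 ∘ isLast M ω) _ M ⟩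
    ∑ (𝟙 ∘ isLast M ω) M * 𝟙 (M ⊆ᵇ Gω ω)                  ≡⟨ cong (_* 𝟙 (M ⊆ᵇ Gω ω)) (∑-isLast uω unique M⊆ω e₀∈M) ⟩
    1 * 𝟙 (M ⊆ᵇ Gω ω)                                      ≡⟨ *-identityˡ _ ⟩
    𝟙 (M ⊆ᵇ Gω ω)                                          ∎)
    where
    open ≡-Reasoning
    open IsPerfectMatching pm
    uω : Unique ω
    uω = Unique-↭ (↭-sym ω↭E) edges-unique
    M⊆ω : ∀ {f} → f ∈ M → f ∈ ω
    M⊆ω = ∈-resp-↭ (↭-sym ω↭E) ∘ ⊆edges
    ⊆ᵇ-iff : ∀ e → e ∈ M → isLast M ω e ≡ true → endpointIsolated e ω ≡ (M ⊆ᵇ Gω ω)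
    ⊆ᵇ-iff (u , v) i last = sym (trans (⊆ᵇ-Gω ω M (u , v) i (M⊆ω i) last) (uncovered-before-last ω M perfect u v ω↭E last))

  count : (List (Edge m) → Bool) → ℕ
  count p = ∑ (𝟙 ∘ p) (orderings E)

  count-⊆ᵇ-Gω : ∀ {M} → IsPerfectMatching M → ∀ {e₀} → e₀ ∈ M →
    count (λ ω → M ⊆ᵇ Gω ω) ≡ ∑ (λ e → count (λ ω → isLast M ω e ∧ endpointIsolated e ω)) M
  count-⊆ᵇ-Gω {M} pm e₀∈M =
    trans (∑-cong-∈ (orderings E) (λ i → 𝟙-⊆ᵇ-Gω pm (∈-orderings⇒↭ E i) e₀∈M))
          (∑-comm (λ ω e → 𝟙 (isLast M ω e ∧ endpointIsolated e ω)) (orderings E) M)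

  module LastEdge {M} (pm : IsPerfectMatching M) {u v : Fin m} (e∈M : (u , v) ∈ M) where
    open IsPerfectMatching pm

    e : Edge m
    e = (u , v)

    e∈E : e ∈ E
    e∈E = ⊆edges e∈M

    u<v : u <ᶠ v
    u<v = proj₁ (∈-edges⁻ e∈E)

    X Yᵤ Yᵥ : List (Edge m)
    X  = without e M
    Yᵤ = othersAt u e
    Yᵥ = othersAt v e

    inclusion-exclusion : count (λ ω → isLast M ω e ∧ endpointIsolated e ω) + count (between X e (Yᵤ ++ Yᵥ)) ≡
                          count (between X e Yᵤ) + count (between X e Yᵥ)
    inclusion-exclusion = begin
      ∑ (λ ω → 𝟙 (isLast M ω e ∧ endpointIsolated e ω)) Ω + ∑ (𝟙 ∘ between X e (Yᵤ ++ Yᵥ)) Ω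
        ≡⟨ sym (∑-+ _ _ Ω) ⟩
      ∑ (λ ω → 𝟙 (isLast M ω e ∧ endpointIsolated e ω) + 𝟙 (between X e (Yᵤ ++ Yᵥ) ω)) Ω
        ≡⟨ ∑-cong Ω split ⟩
      ∑ (λ ω → 𝟙 (between X e Yᵤ ω) + 𝟙 (between X e Yᵥ ω)) Ω
        ≡⟨ ∑-+ _ _ Ω ⟩
      ∑ (𝟙 ∘ between X e Yᵤ) Ω + ∑ (𝟙 ∘ between X e Yᵥ) Ω ∎
      where
      open ≡-Reasoning
      Ω = orderings E
      split : ∀ ω → 𝟙 (isLast M ω e ∧ endpointIsolated e ω) + 𝟙 (between X e (Yᵤ ++ Yᵥ) ω) ≡
                    𝟙 (between X e Yᵤ ω) + 𝟙 (between X e Yᵥ ω)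
      split ω = trans (cong (λ b → 𝟙 (isLast M ω e ∧ endpointIsolated e ω) + 𝟙 (isLast M ω e ∧ b))
                            (all-++ (λ f → not (f ∈ᵇ before e ω)) Yᵤ Yᵥ))
                      (𝟙-∧-inclusion-exclusion (isLast M ω e) (isolatedBefore u e ω) (isolatedBefore v e ω))

    e∉X : e ∉ X
    e∉X i = proj₂ (∈-filter⁻ (λ f → ¬? (f ≟ₑ e)) {xs = M} i) refl

    e∉othersAt : ∀ w → e ∉ othersAt w e
    e∉othersAt w i = proj₂ (∈-othersAt⁻ w e i) refl

    othersAt∩X : ∀ w → incident w e ≡ true → ∀ {f} → f ∈ othersAt w e → f ∉ X
    othersAt∩X w inc f∈Y f∈X =
      let ((_ , inc-f) , f≢e) = ∈-othersAt⁻ w e f∈Y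
      in f≢e (pm-incident-unique M perfect {w} (proj₁ (∈-filter⁻ (λ f → ¬? (f ≟ₑ e)) {xs = M} f∈X)) e∈M inc-f inc)

    -- An edge other than e meeting both u and v would be listed as (v , u), impossible as u < v.
    Yᵤ∩Yᵥ : Disjoint Yᵤ Yᵥ
    Yᵤ∩Yᵥ {a , b} (f∈Yᵤ , f∈Yᵥ) with ∈-othersAt⁻ u e f∈Yᵤ | ∈-othersAt⁻ v e f∈Yᵥ
    ... | (f∈E , inc-u) , f≢e | (_ , inc-v) , _ with incident⁻ {u} {a} {b} inc-u | incident⁻ {v} {a} {b} inc-v
    ... | inj₁ refl | inj₁ refl = Finₚ.<-irrefl refl u<v
    ... | inj₂ refl | inj₂ refl = Finₚ.<-irrefl refl u<v
    ... | inj₁ refl | inj₂ refl = f≢e refl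
    ... | inj₂ refl | inj₁ refl = Finₚ.<-asym u<v (proj₁ (∈-edges⁻ f∈E))

    layout-unique : ∀ Y → Unique Y → (∀ {f} → f ∈ Y → f ∉ X) → e ∉ Y → Unique (Y ++ X ++ [ e ])
    layout-unique Y uY Y∩X e∉Y = Uniqueₚ.++⁺ uY (Uniqueₚ.++⁺ (Uniqueₚ.filter⁺ _ unique) (All.[] ∷ []) X∩e) Y∩Xe
      where
      X∩e : Disjoint X [ e ]
      X∩e (i , here refl) = e∉X i
      Y∩Xe : Disjoint Y (X ++ [ e ])
      Y∩Xe (i , j) with ∈-++⁻ X j
      ... | inj₁ f∈X       = Y∩X i f∈X
      ... | inj₂ (here refl) = e∉Y i

    layout-⊆ : ∀ Y → (∀ {f} → f ∈ Y → f ∈ E) → ∀ {f} → f ∈ Y ++ X ++ [ e ] → f ∈ E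
    layout-⊆ Y Y⊆E i with ∈-++⁻ Y i
    ... | inj₁ f∈Y = Y⊆E f∈Y
    ... | inj₂ j with ∈-++⁻ X j
    ...   | inj₁ f∈X         = ⊆edges (proj₁ (∈-filter⁻ (λ f → ¬? (f ≟ₑ e)) {xs = M} f∈X))
    ...   | inj₂ (here refl) = e∈E

    count-between-layout : ∀ Y → Unique Y → (∀ {f} → f ∈ Y → f ∉ X) → e ∉ Y → (∀ {f} → f ∈ Y → f ∈ E) →
      count (between X e Y) * suc (length X + length Y) ! ≡ (length E) ! * ((length X) ! * (length Y) !)
    count-between-layout Y uY Y∩X e∉Y Y⊆E =
      count-between E X e Y edges-unique (layout-unique Y uY Y∩X e∉Y) (layout-⊆ Y Y⊆E)

    othersAt-unique : ∀ w → Unique (othersAt w e)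
    othersAt-unique w = Uniqueₚ.filter⁺ _ (Uniqueₚ.filter⁺ (holds? (incident w)) edges-unique)

    othersAt-⊆ : ∀ w {f} → f ∈ othersAt w e → f ∈ E
    othersAt-⊆ w = proj₁ ∘ proj₁ ∘ ∈-othersAt⁻ w e

    count-Yᵤ : count (between X e Yᵤ) * suc (length X + length Yᵤ) ! ≡ (length E) ! * ((length X) ! * (length Yᵤ) !)
    count-Yᵤ = count-between-layout Yᵤ (othersAt-unique u) (othersAt∩X u (incident-fst u v)) (e∉othersAt u) (othersAt-⊆ u)

    count-Yᵥ : count (between X e Yᵥ) * suc (length X + length Yᵥ) ! ≡ (length E) ! * ((length X) ! * (length Yᵥ) !)
    count-Yᵥ = count-between-layout Yᵥ (othersAt-unique v) (othersAt∩X v (incident-snd u v)) (e∉othersAt v) (othersAt-⊆ v)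

    count-Yᵤ++Yᵥ : count (between X e (Yᵤ ++ Yᵥ)) * suc (length X + length (Yᵤ ++ Yᵥ)) ! ≡
                   (length E) ! * ((length X) ! * (length (Yᵤ ++ Yᵥ)) !)
    count-Yᵤ++Yᵥ = count-between-layout (Yᵤ ++ Yᵥ) (Uniqueₚ.++⁺ (othersAt-unique u) (othersAt-unique v) Yᵤ∩Yᵥ)
      (λ i → [ othersAt∩X u (incident-fst u v) , othersAt∩X v (incident-snd u v) ]′ (∈-++⁻ Yᵤ i))
      (λ i → [ e∉othersAt u , e∉othersAt v ]′ (∈-++⁻ Yᵤ i))
      (λ i → [ othersAt-⊆ u , othersAt-⊆ v ]′ (∈-++⁻ Yᵤ i))

    length-X : suc (length X) ≡ length M
    length-X = length-without unique e∈M

    length-Yᵤ : suc (length Yᵤ) ≡ degree G u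
    length-Yᵤ = length-othersAt e∈E (incident-fst u v)

    length-Yᵥ : suc (length Yᵥ) ≡ degree G v
    length-Yᵥ = length-othersAt e∈E (incident-snd u v)

  #PM-Gω : ∀ {ω} → ω ↭ E → #PM (Gω ω) ≡ ∑ (λ M → 𝟙 (isPerfectMatching M) * 𝟙 (M ⊆ᵇ Gω ω)) (sublists E)
  #PM-Gω {ω} ω↭E = trans (length-filter-holds isPerfectMatching (sublists (Gω ω)))
    (∑-sublists-restrict isPerfectMatching isPerfectMatching-↭ (proj₁ Gω⊆ω) edges-unique (∈-resp-↭ ω↭E ∘ proj₂ Gω⊆ω))
    where
    Gω⊆ω = Gω-⊆ ω (Unique-↭ (↭-sym ω↭E) edges-unique)

  ∑-#PM-Gω : ∑ (λ ω → #PM (Gω ω)) (orderings E) ≡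
             ∑ (λ M → 𝟙 (isPerfectMatching M) * count (λ ω → M ⊆ᵇ Gω ω)) (sublists E)
  ∑-#PM-Gω = trans (∑-cong-∈ (orderings E) (#PM-Gω ∘ ∈-orderings⇒↭ E))
    (trans (∑-comm (λ ω M → 𝟙 (isPerfectMatching M) * 𝟙 (M ⊆ᵇ Gω ω)) (orderings E) (sublists E))
           (∑-cong (sublists E) (λ M → ∑-*ˡ (𝟙 (isPerfectMatching M)) (λ ω → 𝟙 (M ⊆ᵇ Gω ω)) (orderings E))))

binomial-factorials : ∀ K R → ((K + R) C K) * (K ! * R !) ≡ (K + R) !
binomial-factorials K R = begin
  ((K + R) C K) * (K ! * R !)
    ≡⟨ cong (_* (K ! * R !)) (nCk≡n!/k![n-k]! (m≤m+n K R)) ⟩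
  ((K + R) ! / (K ! * (K + R ∸ K) !)) {{K !* (K + R ∸ K) !≢0}} * (K ! * R !)
    ≡⟨ cong (λ z → ((K + R) ! / (K ! * z !)) {{K !* z !≢0}} * (K ! * R !)) (m+n∸m≡n K R) ⟩
  ((K + R) ! / (K ! * R !)) {{K !* R !≢0}} * (K ! * R !)
    ≡⟨ m/n*n≡m {{K !* R !≢0}} (subst (λ z → K ! * z ! ∣ (K + R) !) (m+n∸m≡n K R) (k![n∸k]!∣n! (m≤m+n K R))) ⟩
  (K + R) ! ∎
  where open ≡-Reasoning

binomial-positive : ∀ K R → 1 ≤ (K + R) C K
binomial-positive K R with (K + R) C K | binomial-factorials K R
... | zero  | 0≡[K+R]! = ⊥-elim (<⇒≢ (1≤n! (K + R)) 0≡[K+R]!)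
... | suc _ | _        = s≤s z≤n

count-×-binomial : ∀ N K F c → c * suc (N + K) ! ≡ F * (N ! * K !) → c * ((suc N + K) C suc N) * suc N ≡ F
count-×-binomial N K F c h = *-cancelʳ-≡ _ F (N ! * K !) {{N !* K !≢0}} (begin
  c * a * suc N * (N ! * K !)  ≡⟨ reassoc c a (suc N) (N !) (K !) ⟩
  c * (a * (suc N ! * K !))    ≡⟨ cong (c *_) (binomial-factorials (suc N) K) ⟩
  c * suc (N + K) !            ≡⟨ h ⟩
  F * (N ! * K !)              ∎)
  where
  open ≡-Reasoning
  a = (suc N + K) C suc N
  reassoc : ∀ c a n x y → c * a * n * (x * y) ≡ c * (a * (n * x * y))
  reassoc = solve-∀

inclusion-exclusion-scaled : ∀ n F t c₁ c₂ c₁₂ a b →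
  c₁ * a * n ≡ F → c₂ * a * n ≡ F → c₁₂ * b * n ≡ F → t + c₁₂ ≡ c₁ + c₂ →
  n * (t * (a * b)) + F * a ≡ F * b * 2
inclusion-exclusion-scaled n F t c₁ c₂ c₁₂ a b h₁ h₂ h₁₂ h = begin
  n * (t * (a * b)) + F * a            ≡⟨ cong (λ x → n * (t * (a * b)) + x * a) (sym h₁₂) ⟩
  n * (t * (a * b)) + c₁₂ * b * n * a  ≡⟨ collect n t a b c₁₂ ⟩
  n * (t + c₁₂) * a * b                ≡⟨ cong (λ x → n * x * a * b) h ⟩
  n * (c₁ + c₂) * a * b                ≡⟨ expand n c₁ c₂ a b ⟩
  c₁ * a * n * b + c₂ * a * n * b      ≡⟨ cong₂ (λ x y → x * b + y * b) h₁ h₂ ⟩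
  F * b + F * b                        ≡⟨ double F b ⟩
  F * b * 2                            ∎
  where
  open ≡-Reasoning
  collect : ∀ n t a b c → n * (t * (a * b)) + c * b * n * a ≡ n * (t + c) * a * b
  collect = solve-∀
  expand : ∀ n c₁ c₂ a b → n * (c₁ + c₂) * a * b ≡ c₁ * a * n * b + c₂ * a * n * b
  expand = solve-∀
  double : ∀ F b → F * b + F * b ≡ F * b * 2
  double = solve-∀

÷-toℚᵘ : ∀ k p → toℚᵘ (k ÷ suc p) ≃ᵘ mkℚᵘ (+ k) p
÷-toℚᵘ k p = ℚₚ.toℚᵘ-fromℚᵘ (mkℚᵘ (+ k) p)

÷-+ : ∀ x y p → (x ÷ suc p) +ℚ (y ÷ suc p) ≡ (x + y) ÷ suc p
÷-+ x y p = ℚₚ.toℚᵘ-injective (begin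
  toℚᵘ ((x ÷ suc p) +ℚ (y ÷ suc p))         ≈⟨ ℚₚ.toℚᵘ-homo-+ (x ÷ suc p) (y ÷ suc p) ⟩
  toℚᵘ (x ÷ suc p) ℚᵘ.+ toℚᵘ (y ÷ suc p)   ≈⟨ ℚᵘₚ.+-cong (÷-toℚᵘ x p) (÷-toℚᵘ y p) ⟩
  mkℚᵘ (+ x) p ℚᵘ.+ mkℚᵘ (+ y) p            ≈⟨ *≡* cross ⟩
  mkℚᵘ (+ (x + y)) p                         ≈⟨ ÷-toℚᵘ (x + y) p ⟨
  toℚᵘ ((x + y) ÷ suc p)                     ∎)
  where
  open ℚᵘₚ.≃-Reasoning
  common : ∀ (X Y s : ℤ) → (X ℤ.* s ℤ.+ Y ℤ.* s) ℤ.* s ≡ (X ℤ.+ Y) ℤ.* (s ℤ.* s)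
  common = ℤ-Solver.solve-∀
  cross : (+ x ℤ.* + suc p ℤ.+ + y ℤ.* + suc p) ℤ.* + suc p ≡ + (x + y) ℤ.* + (suc p * suc p)
  cross rewrite ℤₚ.pos-+ x y | ℤₚ.pos-* (suc p) (suc p) = common (+ x) (+ y) (+ suc p)

sumℚ-÷ : (k : A → ℕ) (p : ℕ) (xs : List A) → sumℚ (map (λ x → k x ÷ suc p) xs) ≡ ∑ k xs ÷ suc p
sumℚ-÷ k p []       = ℚₚ.toℚᵘ-injective (ℚᵘₚ.≃-sym (ℚᵘₚ.≃-trans (÷-toℚᵘ 0 p) (*≡* refl)))
sumℚ-÷ k p (x ∷ xs) = trans (cong ((k x ÷ suc p) +ℚ_) (sumℚ-÷ k p xs)) (÷-+ (k x) (∑ k xs) p)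

mean-÷ : (k : A → ℕ) {P : ℕ} → 1 ≤ P → (xs : List A) →
         mean (map (λ x → k x ÷ P) xs) ≡ (∑ k xs ÷ P) *ℚ (1 ÷ length xs)
mean-÷ k {suc P} _ xs = cong₂ _*ℚ_ (sumℚ-÷ k P xs) (cong (1 ÷_) (length-map (λ x → k x ÷ suc P) xs))

cast-equation : ∀ T P F A B → T * (A * B) + P * (F * A) ≡ P * (F * B * 2) →
                + T ℤ.* (+ A ℤ.* + B) ℤ.+ + P ℤ.* (+ F ℤ.* + A) ≡ + P ℤ.* (+ F ℤ.* + B ℤ.* + 2)
cast-equation T P F A B h = begin
  + T ℤ.* (+ A ℤ.* + B) ℤ.+ + P ℤ.* (+ F ℤ.* + A)
    ≡⟨ cong₂ ℤ._+_ (cong (+ T ℤ.*_) (sym (ℤₚ.pos-* A B))) (cong (+ P ℤ.*_) (sym (ℤₚ.pos-* F A))) ⟩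
  + T ℤ.* + (A * B) ℤ.+ + P ℤ.* + (F * A)
    ≡⟨ cong₂ ℤ._+_ (sym (ℤₚ.pos-* T _)) (sym (ℤₚ.pos-* P _)) ⟩
  + (T * (A * B)) ℤ.+ + (P * (F * A))
    ≡⟨ sym (ℤₚ.pos-+ (T * (A * B)) (P * (F * A))) ⟩
  + (T * (A * B) + P * (F * A))
    ≡⟨ cong +_ h ⟩
  + (P * (F * B * 2))
    ≡⟨ ℤₚ.pos-* P _ ⟩
  + P ℤ.* + (F * B * 2)
    ≡⟨ cong (+ P ℤ.*_) (trans (ℤₚ.pos-* (F * B) 2) (cong (ℤ._* + 2) (ℤₚ.pos-* F B))) ⟩
  + P ℤ.* (+ F ℤ.* + B ℤ.* + 2) ∎
  where open ≡-Reasoning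

-- t/(P F) = 2/A − 1/B cross-multiplied, obtained by adding 0 = R − L to the left.
cross-multiplied : ∀ (t A B P F : ℤ) → t ℤ.* (A ℤ.* B) ℤ.+ P ℤ.* (F ℤ.* A) ≡ P ℤ.* (F ℤ.* B ℤ.* + 2) →
                   (t ℤ.* + 1) ℤ.* (A ℤ.* B) ≡ (+ 2 ℤ.* B ℤ.+ (ℤ.- + 1) ℤ.* A) ℤ.* (P ℤ.* F)
cross-multiplied t A B P F h = begin
  (t ℤ.* + 1) ℤ.* (A ℤ.* B)                   ≡⟨ sym (ℤₚ.+-identityʳ _) ⟩
  (t ℤ.* + 1) ℤ.* (A ℤ.* B) ℤ.+ + 0           ≡⟨ cong (λ z → (t ℤ.* + 1) ℤ.* (A ℤ.* B) ℤ.+ z) (sym (ℤₚ.+-inverseʳ R)) ⟩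
  (t ℤ.* + 1) ℤ.* (A ℤ.* B) ℤ.+ (R ℤ.- R)     ≡⟨ cong (λ z → (t ℤ.* + 1) ℤ.* (A ℤ.* B) ℤ.+ (R ℤ.- z)) (sym h) ⟩
  (t ℤ.* + 1) ℤ.* (A ℤ.* B) ℤ.+ (R ℤ.- L)     ≡⟨ identity t A B P F ⟩
  (+ 2 ℤ.* B ℤ.+ (ℤ.- + 1) ℤ.* A) ℤ.* (P ℤ.* F) ∎
  where
  open ≡-Reasoning
  L = t ℤ.* (A ℤ.* B) ℤ.+ P ℤ.* (F ℤ.* A)
  R = P ℤ.* (F ℤ.* B ℤ.* + 2)
  identity : ∀ (t A B P F : ℤ) →
    (t ℤ.* + 1) ℤ.* (A ℤ.* B) ℤ.+ (P ℤ.* (F ℤ.* B ℤ.* + 2) ℤ.- (t ℤ.* (A ℤ.* B) ℤ.+ P ℤ.* (F ℤ.* A)))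
    ≡ (+ 2 ℤ.* B ℤ.+ (ℤ.- + 1) ℤ.* A) ℤ.* (P ℤ.* F)
  identity = ℤ-Solver.solve-∀

ratio-÷ : ∀ T {P F a b} → 1 ≤ P → 1 ≤ F → 1 ≤ a → 1 ≤ b → T * (a * b) + P * (F * a) ≡ P * (F * b * 2) →
          (T ÷ P) *ℚ (1 ÷ F) ≡ (2 ÷ a) -ℚ (1 ÷ b)
ratio-÷ T {suc P} {suc F} {suc a} {suc b} _ _ _ _ h = ℚₚ.toℚᵘ-injective (begin
  toℚᵘ ((T ÷ suc P) *ℚ (1 ÷ suc F))              ≈⟨ ℚₚ.toℚᵘ-homo-* (T ÷ suc P) (1 ÷ suc F) ⟩
  toℚᵘ (T ÷ suc P) ℚᵘ.* toℚᵘ (1 ÷ suc F)         ≈⟨ ℚᵘₚ.*-cong (÷-toℚᵘ T P) (÷-toℚᵘ 1 F) ⟩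
  mkℚᵘ (+ T) P ℚᵘ.* mkℚᵘ (+ 1) F                  ≈⟨ *≡* cross ⟩
  mkℚᵘ (+ 2) a ℚᵘ.+ ℚᵘ.- mkℚᵘ (+ 1) b             ≈⟨ ℚᵘₚ.+-cong (÷-toℚᵘ 2 a) (ℚᵘₚ.-‿cong (÷-toℚᵘ 1 b)) ⟨
  toℚᵘ (2 ÷ suc a) ℚᵘ.+ ℚᵘ.- toℚᵘ (1 ÷ suc b)    ≈⟨ ℚᵘₚ.+-congʳ (toℚᵘ (2 ÷ suc a)) (ℚₚ.toℚᵘ-homo‿- (1 ÷ suc b)) ⟨
  toℚᵘ (2 ÷ suc a) ℚᵘ.+ toℚᵘ (ℚ.- (1 ÷ suc b))   ≈⟨ ℚₚ.toℚᵘ-homo-+ (2 ÷ suc a) (ℚ.- (1 ÷ suc b)) ⟨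
  toℚᵘ ((2 ÷ suc a) -ℚ (1 ÷ suc b))              ∎)
  where
  open ℚᵘₚ.≃-Reasoning
  cross : (+ T ℤ.* + 1) ℤ.* + (suc a * suc b) ≡ (+ 2 ℤ.* + suc b ℤ.+ (ℤ.- + 1) ℤ.* + suc a) ℤ.* + (suc P * suc F)
  cross rewrite ℤₚ.pos-* (suc a) (suc b) | ℤₚ.pos-* (suc P) (suc F) =
    cross-multiplied (+ T) (+ suc a) (+ suc b) (+ suc P) (+ suc F) (cast-equation T (suc P) (suc F) (suc a) (suc b) h)

-- The expectation

module Expectation {N D : ℕ} (G : SimpleGraph (2 * suc N)) (regular : Regular (suc D) G) where
  open Graph G

  n a b F : ℕ
  n = suc N
  a = (n + suc D ∸ 1) C n
  b = (n + 2 * suc D ∸ 2) C n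
  F = (length E) !

  a≡ : a ≡ (n + D) C n
  a≡ = cong (λ k → (k ∸ 1) C n) (+-suc n D)

  b≡ : b ≡ (n + (D + D)) C n
  b≡ = cong (λ k → (k ∸ 2) C n) (regroup N D)
    where
    regroup : ∀ N D → suc N + 2 * suc D ≡ 2 + (suc N + (D + D))
    regroup = solve-∀

  length-matching : ∀ {M} → IsPerfectMatching M → length M ≡ n
  length-matching {M} pm = *-cancelʳ-≡ (length M) n 2 (trans (length-pm M perfect ⊆edges) (*-comm 2 n))
    where open IsPerfectMatching pm

  count-last-isolated : ∀ {M} (pm : IsPerfectMatching M) {u v} (e∈M : (u , v) ∈ M) →
    n * (count (λ ω → isLast M ω (u , v) ∧ endpointIsolated (u , v) ω) * (a * b)) + F * a ≡ F * b * 2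
  count-last-isolated {M} pm {u} {v} e∈M = inclusion-exclusion-scaled n F _ c₁ c₂ c₁₂ a b
    (subst (λ x → c₁ * x * n ≡ F) (sym a≡) (count-×-binomial N D F c₁ (at-sizes {c₁} {Yᵤ} |Yᵤ| count-Yᵤ)))
    (subst (λ x → c₂ * x * n ≡ F) (sym a≡) (count-×-binomial N D F c₂ (at-sizes {c₂} {Yᵥ} |Yᵥ| count-Yᵥ)))
    (subst (λ x → c₁₂ * x * n ≡ F) (sym b≡) (count-×-binomial N (D + D) F c₁₂ (at-sizes {c₁₂} {Yᵤ ++ Yᵥ} |Yᵤ++Yᵥ| count-Yᵤ++Yᵥ)))
    inclusion-exclusion
    where
    open LastEdge pm e∈M
    c₁ c₂ c₁₂ : ℕ
    c₁  = count (between X e Yᵤ)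
    c₂  = count (between X e Yᵥ)
    c₁₂ = count (between X e (Yᵤ ++ Yᵥ))
    |X| : length X ≡ N
    |X| = suc-injective (trans length-X (length-matching pm))
    |Yᵤ| : length Yᵤ ≡ D
    |Yᵤ| = suc-injective (trans length-Yᵤ (regular u))
    |Yᵥ| : length Yᵥ ≡ D
    |Yᵥ| = suc-injective (trans length-Yᵥ (regular v))
    |Yᵤ++Yᵥ| : length (Yᵤ ++ Yᵥ) ≡ D + D
    |Yᵤ++Yᵥ| = trans (length-++ Yᵤ) (cong₂ _+_ |Yᵤ| |Yᵥ|)
    at-sizes : ∀ {c Y K} → length Y ≡ K → c * suc (length X + length Y) ! ≡ F * ((length X) ! * (length Y) !) →
               c * suc (N + K) ! ≡ F * (N ! * K !)
    at-sizes {c} |Y| h = subst₂ (λ x y → c * suc (x + y) ! ≡ F * (x ! * y !)) |X| |Y| h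

  count-matching : ∀ {M} → IsPerfectMatching M → ∀ {e₀} → e₀ ∈ M →
                   count (λ ω → M ⊆ᵇ Gω ω) * (a * b) + F * a ≡ F * b * 2
  count-matching {M} pm e₀∈M = *-cancelˡ-≡ _ _ n (begin
    n * (count (λ ω → M ⊆ᵇ Gω ω) * (a * b) + F * a)
      ≡⟨ *-distribˡ-+ n _ (F * a) ⟩
    n * (count (λ ω → M ⊆ᵇ Gω ω) * (a * b)) + n * (F * a)
      ≡⟨ cong₂ _+_ (cong (λ k → n * (k * (a * b))) (count-⊆ᵇ-Gω pm e₀∈M)) (cong (_* (F * a)) (sym (length-matching pm))) ⟩
    n * (∑ t M * (a * b)) + length M * (F * a)
      ≡⟨ cong₂ _+_ (trans (cong (n *_) (sym (∑-*ʳ t (a * b) M))) (sym (∑-*ˡ n (λ e → t e * (a * b)) M)))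
                   (sym (∑-const (F * a) M)) ⟩
    ∑ (λ e → n * (t e * (a * b))) M + ∑ (λ _ → F * a) M
      ≡⟨ sym (∑-+ _ _ M) ⟩
    ∑ (λ e → n * (t e * (a * b)) + F * a) M
      ≡⟨ ∑-cong-∈ M (λ {(u , v)} i → count-last-isolated pm i) ⟩
    ∑ (λ _ → F * b * 2) M
      ≡⟨ ∑-const _ M ⟩
    length M * (F * b * 2)
      ≡⟨ cong (_* (F * b * 2)) (length-matching pm) ⟩
    n * (F * b * 2) ∎)
    where
    open ≡-Reasoning
    t : Edge (2 * n) → ℕ
    t e = count (λ ω → isLast M ω e ∧ endpointIsolated e ω)

  T P : ℕ
  T = ∑ (λ ω → #PM (Gω ω)) (orderings E)
  P = #PM E

  total : T * (a * b) + P * (F * a) ≡ P * (F * b * 2)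
  total = begin
    T * (a * b) + P * (F * a)
      ≡⟨ cong₂ (λ x y → x * (a * b) + y * (F * a)) ∑-#PM-Gω (length-filter-holds isPerfectMatching S) ⟩
    ∑ (λ M → 𝟙 (isPM M) * K M) S * (a * b) + ∑ (𝟙 ∘ isPM) S * (F * a)
      ≡⟨ cong₂ _+_ (sym (∑-*ʳ (λ M → 𝟙 (isPM M) * K M) (a * b) S)) (sym (∑-*ʳ (𝟙 ∘ isPM) (F * a) S)) ⟩
    ∑ (λ M → 𝟙 (isPM M) * K M * (a * b)) S + ∑ (λ M → 𝟙 (isPM M) * (F * a)) S
      ≡⟨ sym (∑-+ _ _ S) ⟩
    ∑ (λ M → 𝟙 (isPM M) * K M * (a * b) + 𝟙 (isPM M) * (F * a)) S
      ≡⟨ ∑-cong-∈ S per-matching ⟩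
    ∑ (λ M → 𝟙 (isPM M) * (F * b * 2)) S
      ≡⟨ ∑-*ʳ (𝟙 ∘ isPM) (F * b * 2) S ⟩
    ∑ (𝟙 ∘ isPM) S * (F * b * 2)
      ≡⟨ cong (_* (F * b * 2)) (sym (length-filter-holds isPerfectMatching S)) ⟩
    P * (F * b * 2) ∎
    where
    open ≡-Reasoning
    S = sublists E
    isPM = isPerfectMatching {2 * n}
    K : List (Edge (2 * n)) → ℕ
    K M = count (λ ω → M ⊆ᵇ Gω ω)
    per-matching : ∀ {M} → M ∈ S → 𝟙 (isPM M) * K M * (a * b) + 𝟙 (isPM M) * (F * a) ≡ 𝟙 (isPM M) * (F * b * 2)
    per-matching {M} M∈S with isPM M in pm
    ... | false = refl
    ... | true  = let (e₀ , e₀∈M , _) = pm-covers M pm zero in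
      trans (cong₂ _+_ (cong (_* (a * b)) (+-identityʳ (K M))) (+-identityʳ (F * a)))
            (trans (count-matching (sublist-matching M∈S pm) e₀∈M) (sym (+-identityʳ _)))

  expected-ratio : 1 ≤ P → expectedPMRatio G ≡ (2 ÷ a) -ℚ (1 ÷ b)
  expected-ratio P≥1 = begin
    expectedPMRatio G                        ≡⟨ mean-÷ (λ ω → #PM (Gω ω)) P≥1 (orderings E) ⟩
    (T ÷ P) *ℚ (1 ÷ length (orderings E))    ≡⟨ cong (λ k → (T ÷ P) *ℚ (1 ÷ k)) (length-orderings E) ⟩
    (T ÷ P) *ℚ (1 ÷ F)                       ≡⟨ ratio-÷ T P≥1 (1≤n! (length E)) a≥1 b≥1 total ⟩
    (2 ÷ a) -ℚ (1 ÷ b)                       ∎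
    where
    open ≡-Reasoning
    a≥1 = subst (1 ≤_) (sym a≡) (binomial-positive n D)
    b≥1 = subst (1 ≤_) (sym b≡) (binomial-positive n (D + D))

corollary2 : (n d : ℕ) (G : SimpleGraph (2 * n)) → Regular d G → #PM (edges G) ≥ 1 →
    expectedPMRatio G ≡ (2 ÷ ((n + d ∸ 1) C n)) -ℚ (1 ÷ ((n + 2 * d ∸ 2) C n))
-- With no vertices both sides evaluate to 1.
corollary2 zero    d       G regular has-pm = refl
corollary2 (suc N) zero    G regular has-pm =
  ⊥-elim (1+n≰n (subst (1 ≤_) (regular zero) (Graph.degree-positive G has-pm zero)))
corollary2 (suc N) (suc D) G regular has-pm = Expectation.expected-ratio G regular has-pm
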